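{- Let $a>0$, $k>2$ and $m$ be integers with $k$ odd or $4\mid k$, and let $\zeta_k$ be a primitive $k$-th root of unity. Assume that $-m+\zeta_k$ and $-(m+a)+\zeta_k$ are multiplicatively dependent, that neither is a root of unity, and that $(m,a,k)\neq(-1,2,4)$. Let $S=\{p \text{ prime} : p\mid \Phi_k(m)\Phi_k(m+a)\}$, let $p\in S$ (so that $p\nmid k$), let $f_p=\mathrm{ord}_k(p)$, and let $n=\nu_p\big(\gcd(\Phi_k(m),\Phi_k(m+a))\big)$. Then \[n\leq \left\lfloor \frac{\nu_p(a)}{f_p}\right\rfloor f_p \quad\text{and}\quad f_p\mid n.\]
   Context: Two algebraic numbers $\alpha,\beta$ are called multiplicatively dependent if the equation $\alpha^p=\beta^q$ has a solution in integers $(p,q)\neq(0,0)$. $\Phi_k$ denotes the $k$-th cyclotomic polynomial, $\nu_p$ the $p$-adic valuation, and for $\gcd(b,k)=1$, $\mathrm{ord}_k(b)$ is the smallest positive integer $n$ with $b^n\equiv1\pmod k$. -}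

module Defs where

open import Data.Nat as ℕ using (ℕ; zero; suc; _∸_)
open import Data.Nat.Divisibility as ℕD using (_∣?_)
open import Data.Integer as ℤ using (ℤ; +_; -[1+_]; ∣_∣)
open import Data.List using (List; []; _∷_; _++_; map; foldr; length; replicate; reverse)
open import Data.Product using (_×_; _,_; Σ; ∃)
open import Data.Bool using (Bool; true; false; if_then_else_)
open import Relation.Nullary using (¬_; does)
open import Relation.Binary.PropositionalEquality using (_≡_)

-- Integer polynomials, coefficient lists (constant term first)

Poly : Set
Poly = List ℤ

infixl 6 _+ₚ_ _-ₚ_
infixl 7 _*ₚ_ _·ₚ_

_+ₚ_ : Poly → Poly → Poly
[] +ₚ q = q
(a ∷ p) +ₚ [] = a ∷ p
(a ∷ p) +ₚ (b ∷ q) = (a ℤ.+ b) ∷ (p +ₚ q)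

negₚ : Poly → Poly
negₚ = map (λ x → ℤ.- x)

_-ₚ_ : Poly → Poly → Poly
p -ₚ q = p +ₚ negₚ q

_·ₚ_ : ℤ → Poly → Poly
c ·ₚ p = map (c ℤ.*_) p

_*ₚ_ : Poly → Poly → Poly
[] *ₚ q = []
(a ∷ p) *ₚ q = (a ·ₚ q) +ₚ (+ 0 ∷ (p *ₚ q))

oneₚ : Poly
oneₚ = + 1 ∷ []

_^ₚ_ : Poly → ℕ → Poly
p ^ₚ zero = oneₚ
p ^ₚ suc n = p *ₚ (p ^ₚ n)

monoₚ : ℤ → ℕ → Poly
monoₚ c s = replicate s (+ 0) ++ (c ∷ [])

normalize : Poly → Poly
normalize p = reverse (dropZ (reverse p))
  where
  dropZ : List ℤ → List ℤ
  dropZ [] = []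
  dropZ (+ zero ∷ xs) = dropZ xs
  dropZ (x ∷ xs) = x ∷ xs

lastCoeff : Poly → ℤ
lastCoeff [] = + 0
lastCoeff (a ∷ []) = a
lastCoeff (a ∷ b ∷ p) = lastCoeff (b ∷ p)

-- Long division by a monic polynomial g (fuel-bounded; fuel = length f suffices).
-- Returns (quotient , remainder).
divModMonic′ : ℕ → Poly → Poly → Poly × Poly
divModMonic′ zero f g = [] , normalize f
divModMonic′ (suc fuel) f g with normalize f | normalize g
... | nf | ng with does (length nf ℕ.<? length ng)
... | true = [] , nf
... | false with divModMonic′ fuel (nf -ₚ (monoₚ (lastCoeff nf) s *ₚ ng)) ng
  where s = length nf ∸ length ng
... | q , r = (monoₚ (lastCoeff nf) (length nf ∸ length ng) +ₚ q) , r

divModMonic : Poly → Poly → Poly × Poly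
divModMonic f g = divModMonic′ (length f) f g

quotMonic : Poly → Poly → Poly
quotMonic f g = Data.Product.proj₁ (divModMonic f g)

remMonic : Poly → Poly → Poly
remMonic f g = Data.Product.proj₂ (divModMonic f g)

-- Cyclotomic polynomials, via  x^n - 1 = ∏_{d ∣ n} Φ_d(x)

xⁿ-1 : ℕ → Poly
xⁿ-1 n = monoₚ (+ 1) n -ₚ oneₚ

cycList : ℕ → List (ℕ × Poly)
cycList zero = []
cycList (suc n) = cycList n ++ ((suc n , quotMonic (xⁿ-1 (suc n)) (properDivProd (cycList n))) ∷ [])
  where
  properDivProd : List (ℕ × Poly) → Poly
  properDivProd [] = oneₚ
  properDivProd ((d , φ) ∷ xs) =
    if does (d ∣? suc n) then φ *ₚ properDivProd xs else properDivProd xs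

lastPoly : List (ℕ × Poly) → Poly
lastPoly [] = oneₚ
lastPoly ((_ , φ) ∷ []) = φ
lastPoly (_ ∷ y ∷ ys) = lastPoly (y ∷ ys)

-- Φ k  = k-th cyclotomic polynomial (Φ 0 is set to 1 by convention; unused)
Φ : ℕ → Poly
Φ k = lastPoly (cycList k)

evalℤ : Poly → ℤ → ℤ
evalℤ [] x = + 0
evalℤ (a ∷ p) x = a ℤ.+ x ℤ.* evalℤ p x

-- The ring ℤ[ζ_k] ≅ ℤ[x]/(Φ_k): a polynomial f represents f(ζ_k).
-- f(ζ_k) = g(ζ_k)  iff  Φ_k divides f - g.

_≈[_]_ : Poly → ℕ → Poly → Set
f ≈[ k ] g = remMonic (f -ₚ g) (Φ k) ≡ []

_+ζ : ℤ → Poly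
c +ζ = c ∷ + 1 ∷ []

pos neg : ℤ → ℕ
pos (+ n) = n
pos -[1+ n ] = 0
neg (+ n) = 0
neg -[1+ n ] = suc n

-- α, β ∈ ℤ[ζ_k] (nonzero) are multiplicatively dependent:
-- α^p = β^q for integers (p,q) ≠ (0,0); negative powers cleared:
-- α^{p⁺} β^{q⁻} = β^{q⁺} α^{p⁻}.
MultDep : ℕ → Poly → Poly → Set
MultDep k α β = Σ ℤ λ p → Σ ℤ λ q →
  ¬ (p ≡ + 0 × q ≡ + 0) ×
  ((α ^ₚ pos p) *ₚ (β ^ₚ neg q)) ≈[ k ] ((β ^ₚ pos q) *ₚ (α ^ₚ neg p))

RootOfUnity : ℕ → Poly → Set
RootOfUnity k α = Σ ℕ λ n → (1 ℕ.≤ n) × ((α ^ₚ n) ≈[ k ] oneₚ)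

IsOrd : ℕ → ℕ → ℕ → Set
IsOrd k b f = (1 ℕ.≤ f) × (k ℕD.∣ (b ℕ.^ f ∸ 1)) ×
  ((j : ℕ) → 1 ℕ.≤ j → j ℕ.< f → ¬ (k ℕD.∣ (b ℕ.^ j ∸ 1)))

IsVal : ℕ → ℕ → ℕ → Set
IsVal p x v = (p ℕ.^ v ℕD.∣ x) × ¬ (p ℕ.^ suc v ℕD.∣ x)

-- ⌊ v / f ⌋ · f   (f = 0 never occurs for an order; set to 0 then)
floorDivMul : ℕ → ℕ → ℕ
floorDivMul v zero = 0
floorDivMul v (suc f) = (v ℕ./ suc f) ℕ.* suc f

{-# OPTIONS --safe #-}
-- Since Φ_k is defined by exact division, everything rests on the factorisation
-- x^k - 1 = Φ_k · ∏_{d ∣ k, d < k} Φ_d, proved by strong induction on k from the coprimality over ℚ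
-- of distinct cyclotomic polynomials. If a prime p divides Φ_k(m) and p ∤ k, then m has order k
-- modulo p, so k ∣ p - 1 by Fermat and f_p = 1. Evaluating the dependence relation α^P = β^Q at
-- ζ = m and at ζ = m + a, where α, respectively β, takes the value 0, shows p ∣ a. Finally p^n
-- divides (m + a)^k - m^k = a (k m^(k-1) + a T), whose second factor is prime to p, so n ≤ ν_p(a).
module Submission where

open import Defs
open import Data.Nat as ℕ using (ℕ; zero; suc; z≤n; s≤s; _∸_; _≤_; _<_)
import Data.Nat.Properties as ℕP
open import Data.Nat.Divisibility as ℕD using (_∣_; _∣?_; divides)
open import Data.Nat.DivMod using (n/1≡n)
open import Data.Nat.GCD using (gcd; gcd-GCD; module Bézout; gcd[m,n]∣m; gcd[m,n]∣n; gcd[m,n]≤n; gcd[m,n]≢0)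
open import Data.Nat.Induction using (<-rec)
open import Data.Nat.Primality using (Prime; euclidsLemma; prime⇒nonTrivial; prime⇒nonZero)
open import Data.Integer as ℤ using (ℤ; +_; -[1+_]; ∣_∣; _+_; _*_; -_; _-_; _^_)
import Data.Integer.Properties as ℤP
open import Data.Integer.Divisibility.Signed as ℤD using () renaming (_∣_ to _∣ℤ_)
open import Data.Integer.Tactic.RingSolver using (solve-∀)
open import Data.List using (List; []; _∷_; _++_; _∷ʳ_; [_]; length; map; filter; reverse)
import Data.List.Properties as ListP
open import Data.Bool as Bool using (true; false; if_then_else_)
open import Data.Unit using (tt)
open import Data.Product using (Σ-syntax; _×_; _,_; proj₁; proj₂)
open import Data.Sum as Sum using (_⊎_; inj₁; inj₂; [_,_]′; fromInj₁; fromInj₂)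
open import Data.Empty using (⊥-elim)
open import Function using (_∘_)
open import Relation.Nullary using (¬_; does; yes; no; contradiction)
open import Relation.Binary using (tri<; tri≈; tri>)
open import Relation.Binary.PropositionalEquality hiding ([_])
open ≡-Reasoning


⟦_⟧ : Poly → ℤ → ℤ
⟦_⟧ = evalℤ

eval-+ₚ : ∀ f g x → ⟦ f +ₚ g ⟧ x ≡ ⟦ f ⟧ x + ⟦ g ⟧ x
eval-+ₚ []      g       x = sym (ℤP.+-identityˡ _)
eval-+ₚ (a ∷ f) []      x = sym (ℤP.+-identityʳ _)
eval-+ₚ (a ∷ f) (b ∷ g) x rewrite eval-+ₚ f g x = shuffle a b x _ _
  where
  shuffle : ∀ a b x u v → a + b + x * (u + v) ≡ (a + x * u) + (b + x * v)
  shuffle = solve-∀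

eval-negₚ : ∀ f x → ⟦ negₚ f ⟧ x ≡ - ⟦ f ⟧ x
eval-negₚ []      x = refl
eval-negₚ (a ∷ f) x rewrite eval-negₚ f x = shuffle a x _
  where
  shuffle : ∀ a x u → - a + x * - u ≡ - (a + x * u)
  shuffle = solve-∀

eval--ₚ : ∀ f g x → ⟦ f -ₚ g ⟧ x ≡ ⟦ f ⟧ x - ⟦ g ⟧ x
eval--ₚ f g x rewrite eval-+ₚ f (negₚ g) x | eval-negₚ g x = refl

eval-·ₚ : ∀ c f x → ⟦ c ·ₚ f ⟧ x ≡ c * ⟦ f ⟧ x
eval-·ₚ c []      x = sym (ℤP.*-zeroʳ c)
eval-·ₚ c (a ∷ f) x rewrite eval-·ₚ c f x = shuffle c a x _
  where
  shuffle : ∀ c a x u → c * a + x * (c * u) ≡ c * (a + x * u)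
  shuffle = solve-∀

eval-*ₚ : ∀ f g x → ⟦ f *ₚ g ⟧ x ≡ ⟦ f ⟧ x * ⟦ g ⟧ x
eval-*ₚ []      g x = refl
eval-*ₚ (a ∷ f) g x
  rewrite eval-+ₚ (a ·ₚ g) (+ 0 ∷ (f *ₚ g)) x | eval-·ₚ a g x | eval-*ₚ f g x = shuffle a x _ _
  where
  shuffle : ∀ a x u v → a * v + (+ 0 + x * (u * v)) ≡ (a + x * u) * v
  shuffle = solve-∀

eval-oneₚ : ∀ x → ⟦ oneₚ ⟧ x ≡ + 1
eval-oneₚ x = cong (_+_ (+ 1)) (ℤP.*-zeroʳ x)

eval-^ₚ : ∀ f n x → ⟦ f ^ₚ n ⟧ x ≡ ⟦ f ⟧ x ^ n
eval-^ₚ f zero    x = eval-oneₚ x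
eval-^ₚ f (suc n) x rewrite eval-*ₚ f (f ^ₚ n) x | eval-^ₚ f n x = refl

eval-monoₚ : ∀ c s x → ⟦ monoₚ c s ⟧ x ≡ c * x ^ s
eval-monoₚ c zero    x = shuffle c x
  where
  shuffle : ∀ c x → c + x * + 0 ≡ c * + 1
  shuffle = solve-∀
eval-monoₚ c (suc s) x rewrite eval-monoₚ c s x = shuffle c x (x ^ s)
  where
  shuffle : ∀ c x u → + 0 + x * (c * u) ≡ c * (x * u)
  shuffle = solve-∀

eval-xⁿ-1 : ∀ n x → ⟦ xⁿ-1 n ⟧ x ≡ x ^ n - + 1
eval-xⁿ-1 n x
  rewrite eval--ₚ (monoₚ (+ 1) n) oneₚ x | eval-monoₚ (+ 1) n x | eval-oneₚ x
        | ℤP.*-identityˡ (x ^ n) = refl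

eval-+ζ : ∀ c x → ⟦ c +ζ ⟧ x ≡ c + x
eval-+ζ c x rewrite eval-oneₚ x = cong (_+_ c) (ℤP.*-identityʳ x)

infixr 5 _∷ₜ_

_∷ₜ_ : ℤ → Poly → Poly
a          ∷ₜ (b ∷ f) = a ∷ b ∷ f
+ zero     ∷ₜ []      = []
+ suc n    ∷ₜ []      = + suc n ∷ []
-[1+ n ]   ∷ₜ []      = -[1+ n ] ∷ []

trim : Poly → Poly
trim []      = []
trim (a ∷ f) = a ∷ₜ trim f

trim-∷ʳ0 : ∀ f → trim (f ∷ʳ + 0) ≡ trim f
trim-∷ʳ0 []      = refl
trim-∷ʳ0 (a ∷ f) = cong (a ∷ₜ_) (trim-∷ʳ0 f)

trim-∷ʳ≢0 : ∀ f a → a ≢ + 0 → trim (f ∷ʳ a) ≡ f ∷ʳ a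
trim-∷ʳ≢0 []      (+ zero)   a≢0 = ⊥-elim (a≢0 refl)
trim-∷ʳ≢0 []      (+ suc n)  _   = refl
trim-∷ʳ≢0 []      -[1+ n ]   _   = refl
trim-∷ʳ≢0 (b ∷ f) a          a≢0 rewrite trim-∷ʳ≢0 f a a≢0 = ∷ₜ-∷ʳ f
  where
  ∷ₜ-∷ʳ : ∀ f → b ∷ₜ (f ∷ʳ a) ≡ b ∷ f ∷ʳ a
  ∷ₜ-∷ʳ []      = refl
  ∷ₜ-∷ʳ (c ∷ f) = refl

private
  reverse-drop0-reverse≡trim :
    (drop : Poly → Poly) → drop [] ≡ [] → (∀ f → drop (+ 0 ∷ f) ≡ drop f) →
    (∀ n f → drop (+ suc n ∷ f) ≡ + suc n ∷ f) → (∀ n f → drop (-[1+ n ] ∷ f) ≡ -[1+ n ] ∷ f) →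
    ∀ f → reverse (drop (reverse f)) ≡ trim f
  reverse-drop0-reverse≡trim drop drop-[] drop-0 drop-+ drop-- f = begin
    reverse (drop (reverse f))                      ≡⟨ cong reverse (drop≡ (reverse f)) ⟩
    reverse (reverse (trim (reverse (reverse f)))) ≡⟨ ListP.reverse-involutive _ ⟩
    trim (reverse (reverse f))                      ≡⟨ cong trim (ListP.reverse-involutive f) ⟩
    trim f                                          ∎
    where
    unchanged : ∀ a f → a ≢ + 0 → reverse (trim (reverse (a ∷ f))) ≡ a ∷ f
    unchanged a f a≢0 = begin
      reverse (trim (reverse (a ∷ f))) ≡⟨ cong (reverse ∘ trim) (ListP.unfold-reverse a f) ⟩
      reverse (trim (reverse f ∷ʳ a))  ≡⟨ cong reverse (trim-∷ʳ≢0 (reverse f) a a≢0) ⟩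
      reverse (reverse f ∷ʳ a)         ≡⟨ cong reverse (ListP.unfold-reverse a f) ⟨
      reverse (reverse (a ∷ f))        ≡⟨ ListP.reverse-involutive (a ∷ f) ⟩
      a ∷ f                            ∎
    drop≡ : ∀ f → drop f ≡ reverse (trim (reverse f))
    drop≡ []             = drop-[]
    drop≡ (+ zero ∷ f)   = begin
      drop (+ 0 ∷ f)                   ≡⟨ drop-0 f ⟩
      drop f                           ≡⟨ drop≡ f ⟩
      reverse (trim (reverse f))       ≡⟨ cong reverse (trim-∷ʳ0 (reverse f)) ⟨
      reverse (trim (reverse f ∷ʳ + 0)) ≡⟨ cong (reverse ∘ trim) (ListP.unfold-reverse (+ 0) f) ⟨
      reverse (trim (reverse (+ 0 ∷ f))) ∎
    drop≡ (+ suc n ∷ f)  = trans (drop-+ n f) (sym (unchanged _ f λ ()))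
    drop≡ (-[1+ n ] ∷ f) = trans (drop-- n f) (sym (unchanged _ f λ ()))

-- `normalize` drops zeros with a helper local to its clause, which cannot be named here;
-- abstracting `reverse` makes it the solution of the metavariable `drop` above.
normalize≡trim : ∀ f → normalize f ≡ trim f
normalize≡trim f
  with reverse {A = ℤ} | reverse f
     | reverse-drop0-reverse≡trim _ refl (λ _ → refl) (λ _ _ → refl) (λ _ _ → refl) f
... | _ | _ | eq = eq

eval-∷ₜ : ∀ a f x → ⟦ a ∷ₜ f ⟧ x ≡ a + x * ⟦ f ⟧ x
eval-∷ₜ a          (b ∷ f) x = refl
eval-∷ₜ (+ zero)   []      x = sym (trans (ℤP.+-identityˡ _) (ℤP.*-zeroʳ x))
eval-∷ₜ (+ suc n)  []      x = refl
eval-∷ₜ -[1+ n ]   []      x = refl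

eval-trim : ∀ f x → ⟦ trim f ⟧ x ≡ ⟦ f ⟧ x
eval-trim []      x = refl
eval-trim (a ∷ f) x rewrite eval-∷ₜ a (trim f) x | eval-trim f x = refl

eval-normalize : ∀ f x → ⟦ normalize f ⟧ x ≡ ⟦ f ⟧ x
eval-normalize f x rewrite normalize≡trim f = eval-trim f x

coeff : Poly → ℕ → ℤ
coeff []      i       = + 0
coeff (a ∷ f) zero    = a
coeff (a ∷ f) (suc i) = coeff f i

coeff-∷ₜ : ∀ a f i → coeff (a ∷ₜ f) i ≡ coeff (a ∷ f) i
coeff-∷ₜ a          (b ∷ f) i       = refl
coeff-∷ₜ (+ zero)   []      zero    = refl
coeff-∷ₜ (+ zero)   []      (suc i) = refl
coeff-∷ₜ (+ suc n)  []      i       = refl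
coeff-∷ₜ -[1+ n ]   []      i       = refl

coeff-trim : ∀ f i → coeff (trim f) i ≡ coeff f i
coeff-trim []      i       = refl
coeff-trim (a ∷ f) i       rewrite coeff-∷ₜ a (trim f) i with i
... | zero  = refl
... | suc j = coeff-trim f j

coeff-+ₚ : ∀ f g i → coeff (f +ₚ g) i ≡ coeff f i + coeff g i
coeff-+ₚ []      g       i       = sym (ℤP.+-identityˡ _)
coeff-+ₚ (a ∷ f) []      i       = sym (ℤP.+-identityʳ _)
coeff-+ₚ (a ∷ f) (b ∷ g) zero    = refl
coeff-+ₚ (a ∷ f) (b ∷ g) (suc i) = coeff-+ₚ f g i

coeff-negₚ : ∀ f i → coeff (negₚ f) i ≡ - coeff f i
coeff-negₚ []      i       = refl
coeff-negₚ (a ∷ f) zero    = refl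
coeff-negₚ (a ∷ f) (suc i) = coeff-negₚ f i

coeff--ₚ : ∀ f g i → coeff (f -ₚ g) i ≡ coeff f i - coeff g i
coeff--ₚ f g i rewrite coeff-+ₚ f (negₚ g) i | coeff-negₚ g i = refl

coeff-·ₚ : ∀ c f i → coeff (c ·ₚ f) i ≡ c * coeff f i
coeff-·ₚ c []      i       = sym (ℤP.*-zeroʳ c)
coeff-·ₚ c (a ∷ f) zero    = refl
coeff-·ₚ c (a ∷ f) (suc i) = coeff-·ₚ c f i

DegreeBelow : Poly → ℕ → Set
DegreeBelow f n = ∀ i → n ℕ.≤ i → coeff f i ≡ + 0

DegreeBelow-∷ : ∀ {a f n} → DegreeBelow f n → DegreeBelow (a ∷ f) (suc n)
DegreeBelow-∷ deg (suc i) (s≤s n≤i) = deg i n≤i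

DegreeBelow-tail : ∀ {a f n} → DegreeBelow (a ∷ f) n → DegreeBelow f (ℕ.pred n)
DegreeBelow-tail {n = zero}  deg i _   = deg (suc i) z≤n
DegreeBelow-tail {n = suc n} deg i n≤i = deg (suc i) (s≤s n≤i)

coeff-≥length : ∀ f i → length f ℕ.≤ i → coeff f i ≡ + 0
coeff-≥length []      i       _        = refl
coeff-≥length (a ∷ f) (suc i) (s≤s le) = coeff-≥length f i le

length-trim≤⇒DegreeBelow : ∀ f n → length (trim f) ℕ.≤ n → DegreeBelow f n
length-trim≤⇒DegreeBelow f n le i n≤i =
  trans (sym (coeff-trim f i)) (coeff-≥length (trim f) i (ℕP.≤-trans le n≤i))

length-∷ₜ : ∀ a f → length (a ∷ₜ f) ℕ.≤ suc (length f)
length-∷ₜ a          (b ∷ f) = ℕP.≤-refl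
length-∷ₜ (+ zero)   []      = z≤n
length-∷ₜ (+ suc n)  []      = ℕP.≤-refl
length-∷ₜ -[1+ n ]   []      = ℕP.≤-refl

length-trim : ∀ f → length (trim f) ℕ.≤ length f
length-trim []      = z≤n
length-trim (a ∷ f) = ℕP.≤-trans (length-∷ₜ a (trim f)) (s≤s (length-trim f))

DegreeBelow⇒length-trim≤ : ∀ f n → DegreeBelow f n → length (trim f) ℕ.≤ n
DegreeBelow⇒length-trim≤ []      n       _   = z≤n
DegreeBelow⇒length-trim≤ (a ∷ f) (suc n) deg = ℕP.≤-trans (length-∷ₜ a (trim f))
  (s≤s (DegreeBelow⇒length-trim≤ f n (DegreeBelow-tail deg)))
DegreeBelow⇒length-trim≤ (a ∷ f) zero    deg
  with trim f | DegreeBelow⇒length-trim≤ f 0 (DegreeBelow-tail deg) | deg 0 z≤n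
... | []    | _  | refl = z≤n
... | _ ∷ _ | () | _

zero⊎top : ∀ f → DegreeBelow f 0 ⊎ Σ[ d ∈ ℕ ] DegreeBelow f (suc d) × coeff f d ≢ + 0
zero⊎top []      = inj₁ λ _ _ → refl
zero⊎top (a ∷ f) with zero⊎top f
... | inj₂ (d , deg , top) = inj₂ (suc d , DegreeBelow-∷ deg , top)
... | inj₁ f≈0 with a ℤ.≟ + 0
...   | yes refl = inj₁ λ { zero _ → refl ; (suc i) _ → f≈0 i z≤n }
...   | no a≢0   = inj₂ (0 , DegreeBelow-∷ f≈0 , a≢0)

DegreeBelow0⇒≈0 : ∀ f → DegreeBelow f 0 → ∀ x → ⟦ f ⟧ x ≡ + 0
DegreeBelow0⇒≈0 f deg x with trim f in eq | DegreeBelow⇒length-trim≤ f 0 deg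
... | [] | _ = trans (sym (eval-trim f x)) (cong (λ h → ⟦ h ⟧ x) eq)

monoₚ-degree : ∀ c s → DegreeBelow (monoₚ c s) (suc s)
monoₚ-degree c zero    (suc i) _        = refl
monoₚ-degree c (suc s) (suc i) (s≤s le) = monoₚ-degree c s i le

coeff-monoₚ-top : ∀ c s → coeff (monoₚ c s) s ≡ c
coeff-monoₚ-top c zero    = refl
coeff-monoₚ-top c (suc s) = coeff-monoₚ-top c s

coeff-monoₚ-below : ∀ c s i → i ℕ.< s → coeff (monoₚ c s) i ≡ + 0
coeff-monoₚ-below c (suc s) zero    _         = refl
coeff-monoₚ-below c (suc s) (suc i) (s≤s i<s) = coeff-monoₚ-below c s i i<s

coeff-*ₚ-zero : ∀ a f g → coeff ((a ∷ f) *ₚ g) 0 ≡ a * coeff g 0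
coeff-*ₚ-zero a f g
  rewrite coeff-+ₚ (a ·ₚ g) (+ 0 ∷ (f *ₚ g)) 0 | coeff-·ₚ a g 0 = ℤP.+-identityʳ _

coeff-*ₚ-suc : ∀ a f g i → coeff ((a ∷ f) *ₚ g) (suc i) ≡ a * coeff g (suc i) + coeff (f *ₚ g) i
coeff-*ₚ-suc a f g i
  rewrite coeff-+ₚ (a ·ₚ g) (+ 0 ∷ (f *ₚ g)) (suc i) | coeff-·ₚ a g (suc i) = refl

coeff-*ₚ-const : ∀ a f g → DegreeBelow f 0 → ∀ i → coeff ((a ∷ f) *ₚ g) i ≡ a * coeff g i
DegreeBelow0-*ₚ : ∀ f g → DegreeBelow f 0 → DegreeBelow (f *ₚ g) 0

coeff-*ₚ-const a f g f≈0 zero    = coeff-*ₚ-zero a f g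
coeff-*ₚ-const a f g f≈0 (suc i) = begin
  coeff ((a ∷ f) *ₚ g) (suc i)           ≡⟨ coeff-*ₚ-suc a f g i ⟩
  a * coeff g (suc i) + coeff (f *ₚ g) i ≡⟨ cong (_+_ (a * coeff g (suc i))) (DegreeBelow0-*ₚ f g f≈0 i z≤n) ⟩
  a * coeff g (suc i) + + 0              ≡⟨ ℤP.+-identityʳ _ ⟩
  a * coeff g (suc i)                    ∎

DegreeBelow0-*ₚ []      g _   i _ = refl
DegreeBelow0-*ₚ (a ∷ f) g f≈0 i _ = begin
  coeff ((a ∷ f) *ₚ g) i ≡⟨ coeff-*ₚ-const a f g (DegreeBelow-tail f≈0) i ⟩
  a * coeff g i          ≡⟨ cong (_* coeff g i) (f≈0 0 z≤n) ⟩
  + 0 * coeff g i        ≡⟨ ℤP.*-zeroˡ (coeff g i) ⟩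
  + 0                    ∎

*ₚ-degree : ∀ f g A B → DegreeBelow f (suc A) → DegreeBelow g (suc B) →
            DegreeBelow (f *ₚ g) (suc (A ℕ.+ B)) × coeff (f *ₚ g) (A ℕ.+ B) ≡ coeff f A * coeff g B
*ₚ-degree []      g A       B _    _    = (λ _ _ → refl) , sym (ℤP.*-zeroˡ (coeff g B))
*ₚ-degree (a ∷ f) g zero    B degf degg = degree , coeff-*ₚ-const a f g f≈0 B
  where
  f≈0 = DegreeBelow-tail degf
  degree : DegreeBelow ((a ∷ f) *ₚ g) (suc B)
  degree i B<i = begin
    coeff ((a ∷ f) *ₚ g) i ≡⟨ coeff-*ₚ-const a f g f≈0 i ⟩
    a * coeff g i          ≡⟨ cong (a *_) (degg i B<i) ⟩
    a * + 0                ≡⟨ ℤP.*-zeroʳ a ⟩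
    + 0                    ∎
*ₚ-degree (a ∷ f) g (suc A) B degf degg = degree , top
  where
  ih = *ₚ-degree f g A B (DegreeBelow-tail degf) degg
  degree : DegreeBelow ((a ∷ f) *ₚ g) (suc (suc A ℕ.+ B))
  degree (suc i) (s≤s A+B<i) = begin
    coeff ((a ∷ f) *ₚ g) (suc i)           ≡⟨ coeff-*ₚ-suc a f g i ⟩
    a * coeff g (suc i) + coeff (f *ₚ g) i ≡⟨ cong₂ (λ u v → a * u + v)
                                                 (degg (suc i) (s≤s (ℕP.≤-trans (ℕP.m≤n+m B A) (ℕP.<⇒≤ A+B<i))))
                                                 (proj₁ ih i A+B<i) ⟩
    a * + 0 + + 0                          ≡⟨ cong (_+ + 0) (ℤP.*-zeroʳ a) ⟩
    + 0                                    ∎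
  top : coeff ((a ∷ f) *ₚ g) (suc A ℕ.+ B) ≡ coeff f A * coeff g B
  top = begin
    coeff ((a ∷ f) *ₚ g) (suc (A ℕ.+ B))                    ≡⟨ coeff-*ₚ-suc a f g (A ℕ.+ B) ⟩
    a * coeff g (suc (A ℕ.+ B)) + coeff (f *ₚ g) (A ℕ.+ B) ≡⟨ cong₂ (λ u v → a * u + v)
                                                                  (degg _ (s≤s (ℕP.m≤n+m B A))) (proj₂ ih) ⟩
    a * + 0 + coeff f A * coeff g B                        ≡⟨ cong (_+ coeff f A * coeff g B) (ℤP.*-zeroʳ a) ⟩
    + 0 + coeff f A * coeff g B                            ≡⟨ ℤP.+-identityˡ _ ⟩
    coeff f A * coeff g B                                  ∎

-- A polynomial is determined by its values at 2, 3, 4, …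

sample : ℕ → ℤ
sample t = + suc (suc t)

private
  ≡[2+]*⇒≡0 : ∀ n m → n ≡ suc (suc n) ℕ.* m → m ≡ 0
  ≡[2+]*⇒≡0 n zero    _  = refl
  ≡[2+]*⇒≡0 n (suc m) eq =
    ⊥-elim (ℕP.<-irrefl eq (ℕP.<-≤-trans (ℕP.m<n+m n {2} (s≤s z≤n)) (ℕP.m≤m*n (suc (suc n)) (suc m))))

  sub-cancel : ∀ a b y u v → a + y * u ≡ b + y * v → a - b ≡ y * (v - u)
  sub-cancel a b y u v eq = begin
    a - b                                   ≡⟨ split a b y u v ⟩
    (a + y * u) - (b + y * v) + y * (v - u) ≡⟨ cong (λ w → w - (b + y * v) + y * (v - u)) eq ⟩
    (b + y * v) - (b + y * v) + y * (v - u) ≡⟨ cancel (b + y * v) (y * (v - u)) ⟩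
    y * (v - u)                             ∎
    where
    split : ∀ a b y u v → a - b ≡ (a + y * u) - (b + y * v) + y * (v - u)
    split = solve-∀
    cancel : ∀ u v → u - u + v ≡ v
    cancel = solve-∀

  -- a - b is a multiple of every sample point, in particular of one exceeding |a - b|.
  cancel-sample : ∀ a b (F G : ℕ → ℤ) → (∀ t → a + sample t * F t ≡ b + sample t * G t) →
                  a ≡ b × (∀ t → F t ≡ G t)
  cancel-sample a b F G eq = a≡b , λ t → sym (ℤP.i-j≡0⇒i≡j (G t) (F t) (G-F≡0 t))
    where
    diff : ∀ t → a - b ≡ sample t * (G t - F t)
    diff t = sub-cancel a b (sample t) (F t) (G t) (eq t)
    t₀ = ∣ a - b ∣
    size : t₀ ≡ suc (suc t₀) ℕ.* ∣ G t₀ - F t₀ ∣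
    size = trans (cong ∣_∣ (diff t₀)) (ℤP.abs-* (sample t₀) (G t₀ - F t₀))
    G-F₀ : G t₀ - F t₀ ≡ + 0
    G-F₀ = ℤP.∣i∣≡0⇒i≡0 (≡[2+]*⇒≡0 t₀ _ size)
    a≡b : a ≡ b
    a≡b = ℤP.i-j≡0⇒i≡j a b (begin
      a - b                     ≡⟨ diff t₀ ⟩
      sample t₀ * (G t₀ - F t₀) ≡⟨ cong (sample t₀ *_) G-F₀ ⟩
      sample t₀ * + 0           ≡⟨ ℤP.*-zeroʳ (sample t₀) ⟩
      + 0                       ∎)
    G-F≡0 : ∀ t → G t - F t ≡ + 0
    G-F≡0 t = fromInj₂ (λ ()) (ℤP.i*j≡0⇒i≡0∨j≡0 (sample t) (trans (sym (diff t)) (ℤP.i≡j⇒i-j≡0 a≡b)))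

  eval-[] : ∀ x → + 0 + x * + 0 ≡ + 0
  eval-[] x = trans (ℤP.+-identityˡ _) (ℤP.*-zeroʳ x)

trim-unique-[] : ∀ g → (∀ t → + 0 ≡ ⟦ g ⟧ (sample t)) → [] ≡ trim g
trim-unique-[] []      _  = refl
trim-unique-[] (b ∷ g) eq =
  let 0≡b , 0≈g = cancel-sample (+ 0) b (λ _ → + 0) (⟦ g ⟧ ∘ sample) (λ t → trans (eval-[] (sample t)) (eq t))
  in cong₂ _∷ₜ_ 0≡b (trim-unique-[] g 0≈g)

trim-unique : ∀ f g → (∀ t → ⟦ f ⟧ (sample t) ≡ ⟦ g ⟧ (sample t)) → trim f ≡ trim g
trim-unique []      g       eq = trim-unique-[] g eq
trim-unique (a ∷ f) []      eq = sym (trim-unique-[] (a ∷ f) (sym ∘ eq))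
trim-unique (a ∷ f) (b ∷ g) eq =
  let a≡b , f≈g = cancel-sample a b (⟦ f ⟧ ∘ sample) (⟦ g ⟧ ∘ sample) eq
  in cong₂ _∷ₜ_ a≡b (trim-unique f g f≈g)

≗-on-samples⇒≗ : ∀ f g → (∀ t → ⟦ f ⟧ (sample t) ≡ ⟦ g ⟧ (sample t)) → ⟦ f ⟧ ≗ ⟦ g ⟧
≗-on-samples⇒≗ f g eq x = begin
  ⟦ f ⟧ x        ≡⟨ eval-trim f x ⟨
  ⟦ trim f ⟧ x   ≡⟨ cong (λ h → ⟦ h ⟧ x) (trim-unique f g eq) ⟩
  ⟦ trim g ⟧ x   ≡⟨ eval-trim g x ⟩
  ⟦ g ⟧ x        ∎

coeff-cong : ∀ f g → ⟦ f ⟧ ≗ ⟦ g ⟧ → ∀ i → coeff f i ≡ coeff g i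
coeff-cong f g eq i = begin
  coeff f i        ≡⟨ coeff-trim f i ⟨
  coeff (trim f) i ≡⟨ cong (λ h → coeff h i) (trim-unique f g (eq ∘ sample)) ⟩
  coeff (trim g) i ≡⟨ coeff-trim g i ⟩
  coeff g i        ∎

record Monic (g : Poly) : Set where
  constructor monic
  field
    deg     : ℕ
    below   : DegreeBelow g (suc deg)
    leading : coeff g deg ≡ + 1

coeff-normalize : ∀ f i → coeff (normalize f) i ≡ coeff f i
coeff-normalize f i rewrite normalize≡trim f = coeff-trim f i

lastCoeff≡coeff : ∀ f → lastCoeff f ≡ coeff f (length f ∸ 1)
lastCoeff≡coeff []          = refl
lastCoeff≡coeff (a ∷ [])    = refl
lastCoeff≡coeff (a ∷ b ∷ f) = lastCoeff≡coeff (b ∷ f)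

length-trim-top : ∀ g d → DegreeBelow g (suc d) → coeff g d ≢ + 0 → length (trim g) ≡ suc d
length-trim-top g d g<d top = ℕP.≤-antisym (DegreeBelow⇒length-trim≤ g (suc d) g<d)
  (ℕP.≰⇒> λ len≤d → top (length-trim≤⇒DegreeBelow g d len≤d d ℕP.≤-refl))

private
  1≢0 : + 1 ≢ + 0
  1≢0 ()

private
  quotient-[] : ∀ g r x → ⟦ r ⟧ x ≡ ⟦ [] ⟧ x * ⟦ g ⟧ x + ⟦ r ⟧ x
  quotient-[] g r x = sym (trans (cong (_+ ⟦ r ⟧ x) (ℤP.*-zeroˡ (⟦ g ⟧ x))) (ℤP.+-identityˡ _))

  eval-≡normalize : ∀ f {h} → normalize f ≡ h → ∀ x → ⟦ h ⟧ x ≡ ⟦ f ⟧ x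
  eval-≡normalize f refl x = eval-normalize f x

  add-back : ∀ n m g q r → n - m * g ≡ q * g + r → n ≡ (m + q) * g + r
  add-back n m g q r eq = begin
    n                       ≡⟨ split n m g ⟩
    (n - m * g) + m * g     ≡⟨ cong (_+ m * g) eq ⟩
    q * g + r + m * g       ≡⟨ collect m g q r ⟩
    (m + q) * g + r         ∎
    where
    split : ∀ n m g → n ≡ (n - m * g) + m * g
    split = solve-∀
    collect : ∀ m g q r → q * g + r + m * g ≡ (m + q) * g + r
    collect = solve-∀

divModMonic′-eval : ∀ fuel f g x →
  ⟦ f ⟧ x ≡ ⟦ proj₁ (divModMonic′ fuel f g) ⟧ x * ⟦ g ⟧ x + ⟦ proj₂ (divModMonic′ fuel f g) ⟧ x
divModMonic′-eval zero f g x = trans (sym (eval-normalize f x)) (quotient-[] g (normalize f) x)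
divModMonic′-eval (suc fuel) f g x with normalize f in nf≡ | normalize g in ng≡
... | nf | ng with length nf ℕ.<ᵇ length ng
... | true  = trans (sym (eval-≡normalize f nf≡ x)) (quotient-[] g nf x)
... | false
  with divModMonic′ fuel (nf -ₚ monoₚ (lastCoeff nf) (length nf ∸ length ng) *ₚ ng) ng
     | divModMonic′-eval fuel (nf -ₚ monoₚ (lastCoeff nf) (length nf ∸ length ng) *ₚ ng) ng x
... | q , r | ih = begin
  ⟦ f ⟧ x                                     ≡⟨ eval-≡normalize f nf≡ x ⟨
  ⟦ nf ⟧ x                                    ≡⟨ add-back (⟦ nf ⟧ x) (⟦ M ⟧ x) (⟦ ng ⟧ x) (⟦ q ⟧ x) (⟦ r ⟧ x) ih′ ⟩
  (⟦ M ⟧ x + ⟦ q ⟧ x) * ⟦ ng ⟧ x + ⟦ r ⟧ x    ≡⟨ cong₂ (λ u v → u * v + ⟦ r ⟧ x) (sym (eval-+ₚ M q x)) (eval-≡normalize g ng≡ x) ⟩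
  ⟦ M +ₚ q ⟧ x * ⟦ g ⟧ x + ⟦ r ⟧ x            ∎
  where
  M = monoₚ (lastCoeff nf) (length nf ∸ length ng)
  ih′ : ⟦ nf ⟧ x - ⟦ M ⟧ x * ⟦ ng ⟧ x ≡ ⟦ q ⟧ x * ⟦ ng ⟧ x + ⟦ r ⟧ x
  ih′ = trans (sym (trans (eval--ₚ nf (M *ₚ ng) x) (cong (_-_ (⟦ nf ⟧ x)) (eval-*ₚ M ng x)))) ih

private
  leading-cancel : ∀ f g A L s → DegreeBelow g (suc A) → coeff g A ≡ + 1 → s ℕ.+ A ≡ L → length f ≡ suc L →
                   DegreeBelow (f -ₚ monoₚ (lastCoeff f) s *ₚ g) L
  leading-cancel f g A L s g<A g-lead s+A≡L len i L≤i = vanish i (ℕP.m≤n⇒m<n∨m≡n L≤i)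
    where
    c = lastCoeff f
    prod = *ₚ-degree (monoₚ c s) g s A (monoₚ-degree c s) g<A
    top-f : c ≡ coeff f L
    top-f = trans (lastCoeff≡coeff f) (cong (λ n → coeff f (n ∸ 1)) len)
    top-prod : coeff (monoₚ c s *ₚ g) L ≡ c * + 1
    top-prod = begin
      coeff (monoₚ c s *ₚ g) L         ≡⟨ cong (coeff (monoₚ c s *ₚ g)) s+A≡L ⟨
      coeff (monoₚ c s *ₚ g) (s ℕ.+ A) ≡⟨ proj₂ prod ⟩
      coeff (monoₚ c s) s * coeff g A  ≡⟨ cong₂ _*_ (coeff-monoₚ-top c s) g-lead ⟩
      c * + 1                          ∎
    vanish : ∀ i → L ℕ.< i ⊎ L ≡ i → coeff (f -ₚ monoₚ c s *ₚ g) i ≡ + 0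
    vanish i (inj₁ L<i) = begin
      coeff (f -ₚ monoₚ c s *ₚ g) i        ≡⟨ coeff--ₚ f (monoₚ c s *ₚ g) i ⟩
      coeff f i - coeff (monoₚ c s *ₚ g) i ≡⟨ cong₂ _-_ (coeff-≥length f i (subst (ℕ._≤ i) (sym len) L<i))
                                                    (proj₁ prod i (subst (λ n → suc n ℕ.≤ i) (sym s+A≡L) L<i)) ⟩
      + 0 - + 0                            ≡⟨⟩
      + 0                                  ∎
    vanish i (inj₂ refl) = begin
      coeff (f -ₚ monoₚ c s *ₚ g) L        ≡⟨ coeff--ₚ f (monoₚ c s *ₚ g) L ⟩
      coeff f L - coeff (monoₚ c s *ₚ g) L ≡⟨ cong₂ _-_ (sym top-f) top-prod ⟩
      c - c * + 1                          ≡⟨ cong (_-_ c) (ℤP.*-identityʳ c) ⟩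
      c - c                                ≡⟨ ℤP.+-inverseʳ c ⟩
      + 0                                  ∎

  ∸-split : ∀ n m A → m ≡ suc A → m ℕ.≤ n → Σ[ L ∈ ℕ ] n ≡ suc L × (n ∸ m) ℕ.+ A ≡ L
  ∸-split (suc n) _ A refl (s≤s A≤n) = n , refl , ℕP.m∸n+n≡m A≤n

  division-step : ∀ fuel f g A → DegreeBelow g (suc A) → coeff g A ≡ + 1 → length g ≡ suc A →
    length f ℕ.< suc fuel ℕ.+ suc A → length g ℕ.≤ length f →
    length (trim (f -ₚ monoₚ (lastCoeff f) (length f ∸ length g) *ₚ g)) ℕ.< fuel ℕ.+ suc A
  division-step fuel f g A g<A g-lead g-len f-len g≤f =
    let L , f≡1+L , s+A≡L = ∸-split (length f) (length g) A g-len g≤f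
    in ℕP.≤-<-trans
         (DegreeBelow⇒length-trim≤ (f -ₚ monoₚ (lastCoeff f) (length f ∸ length g) *ₚ g) L
           (leading-cancel f g A L (length f ∸ length g) g<A g-lead s+A≡L f≡1+L))
         (ℕP.≤-pred (subst (ℕ._< suc fuel ℕ.+ suc A) f≡1+L f-len))

  length-≡normalize : ∀ f {h} → normalize f ≡ h → length h ≡ length (trim f)
  length-≡normalize f refl = cong length (normalize≡trim f)

  coeff-≡normalize : ∀ f {h} → normalize f ≡ h → ∀ i → coeff h i ≡ coeff f i
  coeff-≡normalize f refl = coeff-normalize f

divModMonic′-degree : ∀ fuel f g A → DegreeBelow g (suc A) → coeff g A ≡ + 1 →
  length (trim f) ℕ.< fuel ℕ.+ suc A → length (proj₂ (divModMonic′ fuel f g)) ℕ.≤ A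
divModMonic′-degree zero f g A _ _ len rewrite normalize≡trim f = ℕP.≤-pred len
divModMonic′-degree (suc fuel) f g A g<A g-lead len with normalize f in nf≡ | normalize g in ng≡
... | nf | ng with length nf ℕ.<ᵇ length ng in nf<ng
... | true  = ℕP.≤-pred (subst (length nf ℕ.<_) ng-len (ℕP.<ᵇ⇒< _ _ (subst Bool.T (sym nf<ng) tt)))
  where
  ng-len : length ng ≡ suc A
  ng-len = trans (length-≡normalize g ng≡) (length-trim-top g A g<A (λ e → 1≢0 (trans (sym g-lead) e)))
... | false
  with divModMonic′ fuel (nf -ₚ monoₚ (lastCoeff nf) (length nf ∸ length ng) *ₚ ng) ng
     | divModMonic′-degree fuel (nf -ₚ monoₚ (lastCoeff nf) (length nf ∸ length ng) *ₚ ng) ng A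
         (λ i le → trans (coeff-≡normalize g ng≡ i) (g<A i le)) (trans (coeff-≡normalize g ng≡ A) g-lead)
         (division-step fuel nf ng A (λ i le → trans (coeff-≡normalize g ng≡ i) (g<A i le))
            (trans (coeff-≡normalize g ng≡ A) g-lead) ng-len
            (subst (ℕ._< suc fuel ℕ.+ suc A) (sym (length-≡normalize f nf≡)) len)
            (ℕP.≮⇒≥ λ lt → subst Bool.T nf<ng (ℕP.<⇒<ᵇ lt)))
  where
  ng-len : length ng ≡ suc A
  ng-len = trans (length-≡normalize g ng≡) (length-trim-top g A g<A (λ e → 1≢0 (trans (sym g-lead) e)))
... | q , r | ih = ih

quotMonic-eval : ∀ f g x → ⟦ f ⟧ x ≡ ⟦ quotMonic f g ⟧ x * ⟦ g ⟧ x + ⟦ remMonic f g ⟧ x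
quotMonic-eval f g = divModMonic′-eval (length f) f g

remMonic-degree : ∀ f g (m : Monic g) → DegreeBelow (remMonic f g) (Monic.deg m)
remMonic-degree f g (monic A g<A g-lead) i A≤i = coeff-≥length (remMonic f g) i (ℕP.≤-trans
  (divModMonic′-degree (length f) f g A g<A g-lead (ℕP.≤-<-trans (length-trim f) (ℕP.m<m+n (length f) (s≤s z≤n))))
  A≤i)

low-degree-multiple≈0 : ∀ r g W (m : Monic g) → DegreeBelow r (Monic.deg m) →
                        (∀ x → ⟦ r ⟧ x ≡ ⟦ g ⟧ x * ⟦ W ⟧ x) → ∀ x → ⟦ r ⟧ x ≡ + 0
low-degree-multiple≈0 r g W (monic A g<A g-lead) r<A r≈gW = by-top (zero⊎top W)
  where
  by-top : DegreeBelow W 0 ⊎ Σ[ B ∈ ℕ ] DegreeBelow W (suc B) × coeff W B ≢ + 0 → ∀ x → ⟦ r ⟧ x ≡ + 0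
  by-top (inj₁ W≈0) x = begin
    ⟦ r ⟧ x           ≡⟨ r≈gW x ⟩
    ⟦ g ⟧ x * ⟦ W ⟧ x ≡⟨ cong (⟦ g ⟧ x *_) (DegreeBelow0⇒≈0 W W≈0 x) ⟩
    ⟦ g ⟧ x * + 0     ≡⟨ ℤP.*-zeroʳ (⟦ g ⟧ x) ⟩
    + 0               ∎
  by-top (inj₂ (B , W<B , W-top)) = contradiction W-top≡0 W-top
    where
    W-top≡0 : coeff W B ≡ + 0
    W-top≡0 = begin
      coeff W B                    ≡⟨ ℤP.*-identityˡ (coeff W B) ⟨
      + 1 * coeff W B              ≡⟨ cong (_* coeff W B) g-lead ⟨
      coeff g A * coeff W B        ≡⟨ proj₂ (*ₚ-degree g W A B g<A W<B) ⟨
      coeff (g *ₚ W) (A ℕ.+ B)     ≡⟨ coeff-cong r (g *ₚ W) (λ x → trans (r≈gW x) (sym (eval-*ₚ g W x))) (A ℕ.+ B) ⟨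
      coeff r (A ℕ.+ B)            ≡⟨ r<A (A ℕ.+ B) (ℕP.m≤m+n A B) ⟩
      + 0                          ∎

private
  remainder-multiple : ∀ c f q g r w → f ≡ q * g + r → c * f ≡ g * w → c * r ≡ g * (w - c * q)
  remainder-multiple c f q g r w f≡qg+r cf≡gw = begin
    c * r                      ≡⟨ expand c q g r ⟩
    c * (q * g + r) - c * q * g ≡⟨ cong (λ u → c * u - c * q * g) f≡qg+r ⟨
    c * f - c * q * g          ≡⟨ cong (λ u → u - c * q * g) cf≡gw ⟩
    g * w - c * q * g          ≡⟨ factor c q g w ⟩
    g * (w - c * q)            ∎
    where
    expand : ∀ c q g r → c * r ≡ c * (q * g + r) - c * q * g
    expand = solve-∀
    factor : ∀ c q g w → g * w - c * q * g ≡ g * (w - c * q)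
    factor = solve-∀

-- The remainder r satisfies c r = g (W - c q) and has lower degree than g, hence vanishes.
quotMonic-exact : ∀ F g W c → Monic g → c ≢ + 0 → (∀ x → c * ⟦ F ⟧ x ≡ ⟦ g ⟧ x * ⟦ W ⟧ x) →
                  ∀ x → ⟦ F ⟧ x ≡ ⟦ quotMonic F g ⟧ x * ⟦ g ⟧ x
quotMonic-exact F g W c m c≢0 cF≈gW x = begin
  ⟦ F ⟧ x                     ≡⟨ quotMonic-eval F g x ⟩
  ⟦ q ⟧ x * ⟦ g ⟧ x + ⟦ r ⟧ x ≡⟨ cong (_+_ (⟦ q ⟧ x * ⟦ g ⟧ x)) r≈0 ⟩
  ⟦ q ⟧ x * ⟦ g ⟧ x + + 0     ≡⟨ ℤP.+-identityʳ _ ⟩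
  ⟦ q ⟧ x * ⟦ g ⟧ x           ∎
  where
  q = quotMonic F g
  r = remMonic F g
  cr≈g[W-cq] : ∀ x → ⟦ c ·ₚ r ⟧ x ≡ ⟦ g ⟧ x * ⟦ W -ₚ c ·ₚ q ⟧ x
  cr≈g[W-cq] x = begin
    ⟦ c ·ₚ r ⟧ x                      ≡⟨ eval-·ₚ c r x ⟩
    c * ⟦ r ⟧ x                       ≡⟨ remainder-multiple c (⟦ F ⟧ x) (⟦ q ⟧ x) (⟦ g ⟧ x) (⟦ r ⟧ x) (⟦ W ⟧ x)
                                             (quotMonic-eval F g x) (cF≈gW x) ⟩
    ⟦ g ⟧ x * (⟦ W ⟧ x - c * ⟦ q ⟧ x) ≡⟨ cong (⟦ g ⟧ x *_) (trans (eval--ₚ W (c ·ₚ q) x) (cong (_-_ (⟦ W ⟧ x)) (eval-·ₚ c q x))) ⟨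
    ⟦ g ⟧ x * ⟦ W -ₚ c ·ₚ q ⟧ x       ∎
  cr-degree : DegreeBelow (c ·ₚ r) (Monic.deg m)
  cr-degree i le = trans (coeff-·ₚ c r i) (trans (cong (c *_) (remMonic-degree F g m i le)) (ℤP.*-zeroʳ c))
  r≈0 : ⟦ r ⟧ x ≡ + 0
  r≈0 = fromInj₂ (⊥-elim ∘ c≢0) (ℤP.i*j≡0⇒i≡0∨j≡0 c
          (trans (sym (eval-·ₚ c r x)) (low-degree-multiple≈0 (c ·ₚ r) g (W -ₚ c ·ₚ q) m cr-degree cr≈g[W-cq] x)))

Monic-oneₚ : Monic oneₚ
Monic-oneₚ = monic 0 (λ { (suc i) _ → refl }) refl

Monic-xⁿ-1 : ∀ n → Monic (xⁿ-1 (suc n))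
Monic-xⁿ-1 n = monic (suc n) below leading
  where
  below : DegreeBelow (xⁿ-1 (suc n)) (suc (suc n))
  below (suc zero)      (s≤s ())
  below i@(suc (suc _)) le =
    trans (coeff--ₚ (monoₚ (+ 1) (suc n)) oneₚ i) (cong (_- + 0) (monoₚ-degree (+ 1) (suc n) i le))
  leading : coeff (xⁿ-1 (suc n)) (suc n) ≡ + 1
  leading = trans (coeff--ₚ (monoₚ (+ 1) (suc n)) oneₚ (suc n)) (cong (_- + 0) (coeff-monoₚ-top (+ 1) (suc n)))

Monic-*ₚ : ∀ {f g} → Monic f → Monic g → Monic (f *ₚ g)
Monic-*ₚ {f} {g} (monic A f<A f-lead) (monic B g<B g-lead) =
  monic (A ℕ.+ B) (proj₁ prod) (trans (proj₂ prod) (cong₂ _*_ f-lead g-lead))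
  where
  prod = *ₚ-degree f g A B f<A g<B

Monic-≗ : ∀ {f g} → ⟦ f ⟧ ≗ ⟦ g ⟧ → Monic f → Monic g
Monic-≗ {f} {g} f≈g (monic A f<A f-lead) =
  monic A (λ i le → trans (sym (coeff-cong f g f≈g i)) (f<A i le)) (trans (sym (coeff-cong f g f≈g A)) f-lead)

Monic-factor : ∀ F P Q → Monic F → Monic Q → (∀ x → ⟦ F ⟧ x ≡ ⟦ P ⟧ x * ⟦ Q ⟧ x) → Monic P
Monic-factor F P Q (monic n F<n F-lead) (monic A Q<A Q-lead) F≈PQ = by-top (zero⊎top P)
  where
  F≈P*Q : ⟦ F ⟧ ≗ ⟦ P *ₚ Q ⟧
  F≈P*Q x = trans (F≈PQ x) (sym (eval-*ₚ P Q x))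
  by-top : DegreeBelow P 0 ⊎ Σ[ B ∈ ℕ ] DegreeBelow P (suc B) × coeff P B ≢ + 0 → Monic P
  by-top (inj₁ P≈0) = contradiction (trans (sym F-lead) (trans (coeff-cong F (P *ₚ Q) F≈P*Q n)
                        (DegreeBelow0-*ₚ P Q P≈0 n z≤n))) 1≢0
  by-top (inj₂ (B , P<B , P-top)) = monic B P<B (begin
      coeff P B                 ≡⟨ PQ-lead ⟨
      coeff (P *ₚ Q) (B ℕ.+ A)  ≡⟨ coeff-cong F (P *ₚ Q) F≈P*Q (B ℕ.+ A) ⟨
      coeff F (B ℕ.+ A)         ≡⟨ cong (coeff F) B+A≡n ⟩
      coeff F n                 ≡⟨ F-lead ⟩
      + 1                       ∎)
    where
    prod = *ₚ-degree P Q B A P<B Q<A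
    PQ-lead : coeff (P *ₚ Q) (B ℕ.+ A) ≡ coeff P B
    PQ-lead = trans (proj₂ prod) (trans (cong (coeff P B *_) Q-lead) (ℤP.*-identityʳ (coeff P B)))
    B+A≡n : B ℕ.+ A ≡ n
    B+A≡n = ℕP.≤-antisym
      (ℕP.≮⇒≥ λ n<B+A → P-top (trans (sym PQ-lead)
        (trans (sym (coeff-cong F (P *ₚ Q) F≈P*Q (B ℕ.+ A))) (F<n (B ℕ.+ A) n<B+A))))
      (ℕP.≮⇒≥ λ B+A<n → 1≢0 (trans (sym F-lead) (trans (coeff-cong F (P *ₚ Q) F≈P*Q n) (proj₁ prod n B+A<n))))

geoₚ : ℕ → ℕ → Poly
geoₚ s zero    = []
geoₚ s (suc q) = monoₚ (+ 1) (s ℕ.* q) +ₚ geoₚ s q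

Σgeoₚ : ℕ → ℕ → Poly
Σgeoₚ s zero    = []
Σgeoₚ s (suc q) = geoₚ s q +ₚ Σgeoₚ s q

eval-geoₚ-suc : ∀ s q x → ⟦ geoₚ s (suc q) ⟧ x ≡ x ^ (s ℕ.* q) + ⟦ geoₚ s q ⟧ x
eval-geoₚ-suc s q x rewrite eval-+ₚ (monoₚ (+ 1) (s ℕ.* q)) (geoₚ s q) x | eval-monoₚ (+ 1) (s ℕ.* q) x =
  cong (_+ ⟦ geoₚ s q ⟧ x) (ℤP.*-identityˡ (x ^ (s ℕ.* q)))

eval-geoₚ : ∀ s q x → x ^ (s ℕ.* q) - + 1 ≡ (x ^ s - + 1) * ⟦ geoₚ s q ⟧ x
eval-geoₚ s zero    x rewrite ℕP.*-zeroʳ s = sym (ℤP.*-zeroʳ (x ^ s - + 1))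
eval-geoₚ s (suc q) x = begin
  x ^ (s ℕ.* suc q) - + 1                                  ≡⟨ cong (λ n → x ^ n - + 1) (ℕP.*-suc s q) ⟩
  x ^ (s ℕ.+ s ℕ.* q) - + 1                                ≡⟨ cong (_- + 1) (ℤP.^-distribˡ-+-* x s (s ℕ.* q)) ⟩
  x ^ s * x ^ (s ℕ.* q) - + 1                              ≡⟨ telescope (x ^ s) (x ^ (s ℕ.* q)) ⟩
  (x ^ s - + 1) * x ^ (s ℕ.* q) + (x ^ (s ℕ.* q) - + 1)    ≡⟨ cong (_+_ ((x ^ s - + 1) * x ^ (s ℕ.* q))) (eval-geoₚ s q x) ⟩
  (x ^ s - + 1) * x ^ (s ℕ.* q) + (x ^ s - + 1) * ⟦ geoₚ s q ⟧ x ≡⟨ ℤP.*-distribˡ-+ (x ^ s - + 1) _ _ ⟨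
  (x ^ s - + 1) * (x ^ (s ℕ.* q) + ⟦ geoₚ s q ⟧ x)         ≡⟨ cong ((x ^ s - + 1) *_) (eval-geoₚ-suc s q x) ⟨
  (x ^ s - + 1) * ⟦ geoₚ s (suc q) ⟧ x                     ∎
  where
  telescope : ∀ y z → y * z - + 1 ≡ (y - + 1) * z + (z - + 1)
  telescope = solve-∀

eval-Σgeoₚ : ∀ s q x → ⟦ geoₚ s q ⟧ x - + q ≡ (x ^ s - + 1) * ⟦ Σgeoₚ s q ⟧ x
eval-Σgeoₚ s zero    x = sym (ℤP.*-zeroʳ (x ^ s - + 1))
eval-Σgeoₚ s (suc q) x = begin
  ⟦ geoₚ s (suc q) ⟧ x - + suc q                          ≡⟨ cong (_- + suc q) (eval-geoₚ-suc s q x) ⟩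
  (x ^ (s ℕ.* q) + ⟦ geoₚ s q ⟧ x) - (+ 1 + + q)          ≡⟨ regroup (x ^ (s ℕ.* q)) (⟦ geoₚ s q ⟧ x) (+ q) ⟩
  (x ^ (s ℕ.* q) - + 1) + (⟦ geoₚ s q ⟧ x - + q)          ≡⟨ cong₂ _+_ (eval-geoₚ s q x) (eval-Σgeoₚ s q x) ⟩
  (x ^ s - + 1) * ⟦ geoₚ s q ⟧ x + (x ^ s - + 1) * ⟦ Σgeoₚ s q ⟧ x ≡⟨ ℤP.*-distribˡ-+ (x ^ s - + 1) _ _ ⟨
  (x ^ s - + 1) * (⟦ geoₚ s q ⟧ x + ⟦ Σgeoₚ s q ⟧ x)      ≡⟨ cong ((x ^ s - + 1) *_) (eval-+ₚ (geoₚ s q) (Σgeoₚ s q) x) ⟨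
  (x ^ s - + 1) * ⟦ Σgeoₚ s (suc q) ⟧ x                   ∎
  where
  regroup : ∀ y g q → (y + g) - (+ 1 + q) ≡ (y - + 1) + (g - q)
  regroup = solve-∀

private
  combine : ∀ Xd XD XE A B GD GE → A ≡ Xd * B → A - + 1 ≡ (XD - + 1) * GD → B - + 1 ≡ (XE - + 1) * GE →
            GD * (XD - + 1) + - (Xd * GE) * (XE - + 1) ≡ Xd - + 1
  combine Xd XD XE A B GD GE A≡XdB A-1 B-1 = begin
    GD * (XD - + 1) + - (Xd * GE) * (XE - + 1) ≡⟨ regroup Xd XD XE GD GE ⟩
    (XD - + 1) * GD - Xd * ((XE - + 1) * GE)        ≡⟨ cong₂ (λ u v → u - Xd * v) A-1 B-1 ⟨
    (A - + 1) - Xd * (B - + 1)                      ≡⟨ cong (λ u → (u - + 1) - Xd * (B - + 1)) A≡XdB ⟩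
    (Xd * B - + 1) - Xd * (B - + 1)                 ≡⟨ cancel Xd B ⟩
    Xd - + 1                                        ∎
    where
    regroup : ∀ Xd XD XE GD GE → GD * (XD - + 1) + - (Xd * GE) * (XE - + 1) ≡ (XD - + 1) * GD - Xd * ((XE - + 1) * GE)
    regroup = solve-∀
    cancel : ∀ Xd B → (Xd * B - + 1) - Xd * (B - + 1) ≡ Xd - + 1
    cancel = solve-∀

  -- from  d + b E = a D:  x^d - 1 = (x^(aD) - 1) - x^d (x^(bE) - 1)
  bézout-combination : ∀ d D E a b → d ℕ.+ b ℕ.* E ≡ a ℕ.* D → ∀ x →
    ⟦ geoₚ D a ⟧ x * (x ^ D - + 1) + ⟦ negₚ (monoₚ (+ 1) d *ₚ geoₚ E b) ⟧ x * (x ^ E - + 1) ≡ x ^ d - + 1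
  bézout-combination d D E a b eq x
    rewrite eval-negₚ (monoₚ (+ 1) d *ₚ geoₚ E b) x | eval-*ₚ (monoₚ (+ 1) d) (geoₚ E b) x
          | eval-monoₚ (+ 1) d x | ℤP.*-identityˡ (x ^ d) =
    combine (x ^ d) (x ^ D) (x ^ E) (x ^ (D ℕ.* a)) (x ^ (E ℕ.* b)) (⟦ geoₚ D a ⟧ x) (⟦ geoₚ E b ⟧ x)
      exponents (eval-geoₚ D a x) (eval-geoₚ E b x)
    where
    exponents : x ^ (D ℕ.* a) ≡ x ^ d * x ^ (E ℕ.* b)
    exponents = begin
      x ^ (D ℕ.* a)            ≡⟨ cong (x ^_) (trans (ℕP.*-comm D a) (sym eq)) ⟩
      x ^ (d ℕ.+ b ℕ.* E)      ≡⟨ cong (λ n → x ^ (d ℕ.+ n)) (ℕP.*-comm b E) ⟩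
      x ^ (d ℕ.+ E ℕ.* b)      ≡⟨ ℤP.^-distribˡ-+-* x d (E ℕ.* b) ⟩
      x ^ d * x ^ (E ℕ.* b)    ∎

x^gcd-1-combination : ∀ D E → Σ[ U ∈ Poly ] Σ[ V ∈ Poly ]
  ∀ x → ⟦ U ⟧ x * (x ^ D - + 1) + ⟦ V ⟧ x * (x ^ E - + 1) ≡ x ^ gcd D E - + 1
x^gcd-1-combination D E = from-identity (Bézout.identity (gcd-GCD D E))
  where
  from-identity : Bézout.Identity (gcd D E) D E → Σ[ U ∈ Poly ] Σ[ V ∈ Poly ]
    ∀ x → ⟦ U ⟧ x * (x ^ D - + 1) + ⟦ V ⟧ x * (x ^ E - + 1) ≡ x ^ gcd D E - + 1
  from-identity (Bézout.+- a b eq) =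
    geoₚ D a , negₚ (monoₚ (+ 1) (gcd D E) *ₚ geoₚ E b) , bézout-combination (gcd D E) D E a b eq
  from-identity (Bézout.-+ a b eq) = V , geoₚ E b ,
    λ x → trans (ℤP.+-comm (⟦ V ⟧ x * (x ^ D - + 1)) (⟦ geoₚ E b ⟧ x * (x ^ E - + 1)))
                (bézout-combination (gcd D E) E D b a eq x)
    where
    V = negₚ (monoₚ (+ 1) (gcd D E) *ₚ geoₚ D a)

-- Cyclotomic polynomials

[1‥_] : ℕ → List ℕ
[1‥ zero  ] = []
[1‥ suc n ] = [1‥ n ] ++ [ suc n ]

Φ∏ : List ℕ → Poly
Φ∏ []       = oneₚ
Φ∏ (d ∷ ds) = Φ d *ₚ Φ∏ ds

divisorProd : ℕ → ℕ → Poly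
divisorProd N j = Φ∏ (filter (_∣? N) [1‥ j ])

properDivProd : ℕ → List (ℕ × Poly) → Poly
properDivProd N []             = oneₚ
properDivProd N ((d , φ) ∷ xs) = if does (d ∣? N) then φ *ₚ properDivProd N xs else properDivProd N xs

private
  lastPoly-∷ʳ : ∀ xs d φ → lastPoly (xs ++ [ (d , φ) ]) ≡ φ
  lastPoly-∷ʳ []           d φ = refl
  lastPoly-∷ʳ (x ∷ [])     d φ = refl
  lastPoly-∷ʳ (x ∷ y ∷ xs) d φ = lastPoly-∷ʳ (y ∷ xs) d φ

  properDivProd-unique : ∀ N (P : List (ℕ × Poly) → Poly) → P [] ≡ oneₚ →
    (∀ d φ xs → P ((d , φ) ∷ xs) ≡ (if does (d ∣? N) then φ *ₚ P xs else P xs)) →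
    ∀ xs → P xs ≡ properDivProd N xs
  properDivProd-unique N P P[] P∷ []             = P[]
  properDivProd-unique N P P[] P∷ ((d , φ) ∷ xs) = trans (P∷ d φ xs)
    (cong (λ p → if does (d ∣? N) then φ *ₚ p else p) (properDivProd-unique N P P[] P∷ xs))

  -- `cycList` multiplies with a helper local to its clause, which cannot be named here. Once
  -- `cycList n`, `reverse` and `_<ᵇ_` are abstracted, the unfolded `quotMonic` is stuck and
  -- unification instantiates `P` above with that helper.
  Φ-suc-cycList : ∀ n → Φ (suc n) ≡ quotMonic (xⁿ-1 (suc n)) (properDivProd (suc n) (cycList n))
  Φ-suc-cycList n
    with cycList n | reverse {A = ℤ} | ℕ._<ᵇ_
       | cong (quotMonic (xⁿ-1 (suc n))) (properDivProd-unique (suc n) _ refl (λ _ _ _ → refl) (cycList n))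
  ... | L | _ | _ | eq = trans (lastPoly-∷ʳ L (suc n) _) eq

  cycList≡ : ∀ n → cycList n ≡ map (λ d → d , Φ d) [1‥ n ]
  cycList≡ zero    = refl
  cycList≡ (suc n) = begin
    cycList n ++ [ (suc n , _) ]                      ≡⟨ cong (λ φ → cycList n ++ [ (suc n , φ) ]) (sym (lastPoly-∷ʳ (cycList n) (suc n) _)) ⟩
    cycList n ++ [ (suc n , Φ (suc n)) ]              ≡⟨ cong (_++ [ (suc n , Φ (suc n)) ]) (cycList≡ n) ⟩
    map (λ d → d , Φ d) [1‥ n ] ++ [ (suc n , Φ (suc n)) ] ≡⟨ ListP.map-++ (λ d → d , Φ d) [1‥ n ] [ suc n ] ⟨
    map (λ d → d , Φ d) [1‥ suc n ]                   ∎

  properDivProd-map : ∀ N ds → properDivProd N (map (λ d → d , Φ d) ds) ≡ Φ∏ (filter (_∣? N) ds)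
  properDivProd-map N []       = refl
  properDivProd-map N (d ∷ ds) with d ∣? N
  ... | yes _ = cong (Φ d *ₚ_) (properDivProd-map N ds)
  ... | no  _ = properDivProd-map N ds

Φ-suc : ∀ n → Φ (suc n) ≡ quotMonic (xⁿ-1 (suc n)) (divisorProd (suc n) n)
Φ-suc n = trans (Φ-suc-cycList n) (cong (quotMonic (xⁿ-1 (suc n)))
  (trans (cong (properDivProd (suc n)) (cycList≡ n)) (properDivProd-map (suc n) [1‥ n ])))

eval-Φ∏-++ : ∀ xs ys x → ⟦ Φ∏ (xs ++ ys) ⟧ x ≡ ⟦ Φ∏ xs ⟧ x * ⟦ Φ∏ ys ⟧ x
eval-Φ∏-++ []       ys x = sym (trans (cong (_* ⟦ Φ∏ ys ⟧ x) (eval-oneₚ x)) (ℤP.*-identityˡ (⟦ Φ∏ ys ⟧ x)))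
eval-Φ∏-++ (d ∷ xs) ys x
  rewrite eval-*ₚ (Φ d) (Φ∏ (xs ++ ys)) x | eval-*ₚ (Φ d) (Φ∏ xs) x | eval-Φ∏-++ xs ys x =
  sym (ℤP.*-assoc (⟦ Φ d ⟧ x) (⟦ Φ∏ xs ⟧ x) (⟦ Φ∏ ys ⟧ x))

divisorProd-∣ : ∀ N j → suc j ∣ N → ∀ x → ⟦ divisorProd N (suc j) ⟧ x ≡ ⟦ divisorProd N j ⟧ x * ⟦ Φ (suc j) ⟧ x
divisorProd-∣ N j j+1∣N x = begin
  ⟦ divisorProd N (suc j) ⟧ x                                   ≡⟨ cong (λ ds → ⟦ Φ∏ ds ⟧ x) filter≡ ⟩
  ⟦ Φ∏ (filter (_∣? N) [1‥ j ] ++ [ suc j ]) ⟧ x                ≡⟨ eval-Φ∏-++ (filter (_∣? N) [1‥ j ]) [ suc j ] x ⟩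
  ⟦ divisorProd N j ⟧ x * ⟦ Φ (suc j) *ₚ oneₚ ⟧ x               ≡⟨ cong (⟦ divisorProd N j ⟧ x *_) single ⟩
  ⟦ divisorProd N j ⟧ x * ⟦ Φ (suc j) ⟧ x                       ∎
  where
  filter≡ : filter (_∣? N) [1‥ suc j ] ≡ filter (_∣? N) [1‥ j ] ++ [ suc j ]
  filter≡ = trans (ListP.filter-++ (_∣? N) [1‥ j ] [ suc j ])
                  (cong (filter (_∣? N) [1‥ j ] ++_) (ListP.filter-accept (_∣? N) j+1∣N))
  single : ⟦ Φ (suc j) *ₚ oneₚ ⟧ x ≡ ⟦ Φ (suc j) ⟧ x
  single = trans (eval-*ₚ (Φ (suc j)) oneₚ x)
                 (trans (cong (⟦ Φ (suc j) ⟧ x *_) (eval-oneₚ x)) (ℤP.*-identityʳ (⟦ Φ (suc j) ⟧ x)))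

divisorProd-∤ : ∀ N j → ¬ suc j ∣ N → divisorProd N (suc j) ≡ divisorProd N j
divisorProd-∤ N j j+1∤N = cong Φ∏ (begin
  filter (_∣? N) ([1‥ j ] ++ [ suc j ])               ≡⟨ ListP.filter-++ (_∣? N) [1‥ j ] [ suc j ] ⟩
  filter (_∣? N) [1‥ j ] ++ filter (_∣? N) [ suc j ] ≡⟨ cong (filter (_∣? N) [1‥ j ] ++_) (ListP.filter-reject (_∣? N) j+1∤N) ⟩
  filter (_∣? N) [1‥ j ] ++ []                       ≡⟨ ListP.++-identityʳ _ ⟩
  filter (_∣? N) [1‥ j ]                             ∎)

divisorProd-stable : ∀ g k → divisorProd (suc g) (suc g ℕ.+ k) ≡ divisorProd (suc g) (suc g)
divisorProd-stable g zero    = cong (divisorProd (suc g)) (ℕP.+-identityʳ (suc g))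
divisorProd-stable g (suc k) = begin
  divisorProd (suc g) (suc g ℕ.+ suc k)  ≡⟨ cong (divisorProd (suc g)) (ℕP.+-suc (suc g) k) ⟩
  divisorProd (suc g) (suc (suc g ℕ.+ k)) ≡⟨ divisorProd-∤ (suc g) (suc g ℕ.+ k) too-big ⟩
  divisorProd (suc g) (suc g ℕ.+ k)      ≡⟨ divisorProd-stable g k ⟩
  divisorProd (suc g) (suc g)            ∎
  where
  too-big : ¬ suc (suc g ℕ.+ k) ∣ suc g
  too-big d = ℕP.<⇒≱ (s≤s (ℕP.m≤m+n (suc g) k)) (ℕD.∣⇒≤ d)

divisorProd-factor : ∀ g d j → g ∣ d → Σ[ T ∈ Poly ] ∀ x → ⟦ divisorProd d j ⟧ x ≡ ⟦ divisorProd g j ⟧ x * ⟦ T ⟧ x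
divisorProd-factor g d zero    g∣d = oneₚ , λ x → trans (eval-oneₚ x) (sym (cong₂ _*_ (eval-oneₚ x) (eval-oneₚ x)))
divisorProd-factor g d (suc j) g∣d with divisorProd-factor g d j g∣d | suc j ∣? g | suc j ∣? d
... | T , eq | yes ∣g | yes ∣d = T , λ x → begin
  ⟦ divisorProd d (suc j) ⟧ x                            ≡⟨ divisorProd-∣ d j ∣d x ⟩
  ⟦ divisorProd d j ⟧ x * ⟦ Φ (suc j) ⟧ x                ≡⟨ cong (_* ⟦ Φ (suc j) ⟧ x) (eq x) ⟩
  ⟦ divisorProd g j ⟧ x * ⟦ T ⟧ x * ⟦ Φ (suc j) ⟧ x      ≡⟨ swap (⟦ divisorProd g j ⟧ x) (⟦ T ⟧ x) (⟦ Φ (suc j) ⟧ x) ⟩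
  ⟦ divisorProd g j ⟧ x * ⟦ Φ (suc j) ⟧ x * ⟦ T ⟧ x      ≡⟨ cong (_* ⟦ T ⟧ x) (divisorProd-∣ g j ∣g x) ⟨
  ⟦ divisorProd g (suc j) ⟧ x * ⟦ T ⟧ x                  ∎
  where
  swap : ∀ a b c → a * b * c ≡ a * c * b
  swap = solve-∀
... | _      | yes ∣g | no ∤d = contradiction (ℕD.∣-trans ∣g g∣d) ∤d
... | T , eq | no ∤g  | yes ∣d = T *ₚ Φ (suc j) , λ x → begin
  ⟦ divisorProd d (suc j) ⟧ x                            ≡⟨ divisorProd-∣ d j ∣d x ⟩
  ⟦ divisorProd d j ⟧ x * ⟦ Φ (suc j) ⟧ x                ≡⟨ cong (_* ⟦ Φ (suc j) ⟧ x) (eq x) ⟩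
  ⟦ divisorProd g j ⟧ x * ⟦ T ⟧ x * ⟦ Φ (suc j) ⟧ x      ≡⟨ ℤP.*-assoc (⟦ divisorProd g j ⟧ x) (⟦ T ⟧ x) (⟦ Φ (suc j) ⟧ x) ⟩
  ⟦ divisorProd g j ⟧ x * (⟦ T ⟧ x * ⟦ Φ (suc j) ⟧ x)    ≡⟨ cong₂ _*_ (cong (λ p → ⟦ p ⟧ x) (divisorProd-∤ g j ∤g))
                                                                    (eval-*ₚ T (Φ (suc j)) x) ⟨
  ⟦ divisorProd g (suc j) ⟧ x * ⟦ T *ₚ Φ (suc j) ⟧ x     ∎
... | T , eq | no ∤g  | no ∤d = T , λ x → begin
  ⟦ divisorProd d (suc j) ⟧ x     ≡⟨ cong (λ p → ⟦ p ⟧ x) (divisorProd-∤ d j ∤d) ⟩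
  ⟦ divisorProd d j ⟧ x           ≡⟨ eq x ⟩
  ⟦ divisorProd g j ⟧ x * ⟦ T ⟧ x ≡⟨ cong (λ p → ⟦ p ⟧ x * ⟦ T ⟧ x) (divisorProd-∤ g j ∤g) ⟨
  ⟦ divisorProd g (suc j) ⟧ x * ⟦ T ⟧ x ∎

Monic-divisorProd : ∀ N j → (∀ d → d ℕ.< j → Monic (Φ (suc d))) → Monic (divisorProd N j)
Monic-divisorProd N zero    _     = Monic-oneₚ
Monic-divisorProd N (suc j) Φ-monic with suc j ∣? N
... | yes ∣N = Monic-≗ (λ x → trans (eval-*ₚ (divisorProd N j) (Φ (suc j)) x) (sym (divisorProd-∣ N j ∣N x)))
                 (Monic-*ₚ (Monic-divisorProd N j (λ d d<j → Φ-monic d (ℕP.m<n⇒m<1+n d<j))) (Φ-monic j ℕP.≤-refl))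
... | no ∤N  = subst Monic (sym (divisorProd-∤ N j ∤N)) (Monic-divisorProd N j (λ d d<j → Φ-monic d (ℕP.m<n⇒m<1+n d<j)))

record CyclotomicIdentity (n : ℕ) : Set where
  field
    Φ-monic       : Monic (Φ (suc n))
    factorisation : ∀ x → x ^ suc n - + 1 ≡ ⟦ Φ (suc n) ⟧ x * ⟦ divisorProd (suc n) n ⟧ x

open CyclotomicIdentity

x^N-1≡divisorProd : ∀ {n} → CyclotomicIdentity n → ∀ x → x ^ suc n - + 1 ≡ ⟦ divisorProd (suc n) (suc n) ⟧ x
x^N-1≡divisorProd {n} cyc x = begin
  x ^ suc n - + 1                                        ≡⟨ factorisation cyc x ⟩
  ⟦ Φ (suc n) ⟧ x * ⟦ divisorProd (suc n) n ⟧ x          ≡⟨ ℤP.*-comm (⟦ Φ (suc n) ⟧ x) _ ⟩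
  ⟦ divisorProd (suc n) n ⟧ x * ⟦ Φ (suc n) ⟧ x          ≡⟨ divisorProd-∣ (suc n) n ℕD.∣-refl x ⟨
  ⟦ divisorProd (suc n) (suc n) ⟧ x                      ∎

private
  pos-^ : ∀ a n → + (a ℕ.^ n) ≡ (+ a) ^ n
  pos-^ a zero    = refl
  pos-^ a (suc n) = trans (ℤP.pos-* a (a ℕ.^ n)) (cong (_*_ (+ a)) (pos-^ a n))

  sample^-1≢0 : ∀ t n → sample t ^ suc n - + 1 ≢ + 0
  sample^-1≢0 t n eq = [ (λ ()) , (λ ()) ]′ (ℕP.m^n≡1⇒n≡0∨m≡1 (suc (suc t)) (suc n)
    (ℤP.+-injective (trans (pos-^ (suc (suc t)) (suc n)) (ℤP.i-j≡0⇒i≡j (sample t ^ suc n) (+ 1) eq))))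

-- geoₚ G q = (x^D - 1)/(x^G - 1), and T is the product of the Φ_e with e ∣ D, e ∤ G.
Φ-∣-geo : ∀ d' g' q → CyclotomicIdentity d' → CyclotomicIdentity g' → suc d' ≡ q ℕ.* suc g' → g' ℕ.< d' →
          Σ[ T ∈ Poly ] ∀ x → ⟦ geoₚ (suc g') q ⟧ x ≡ ⟦ Φ (suc d') ⟧ x * ⟦ T ⟧ x
Φ-∣-geo d' g' q cyc-d cyc-g D≡qG g'<d' =
  T , λ x → trans (≗-on-samples⇒≗ (geoₚ G q) (Φ D *ₚ T) on-samples x) (eval-*ₚ (Φ D) T x)
  where
  D = suc d'
  G = suc g'
  factor = divisorProd-factor G D d' (divides q D≡qG)
  T = proj₁ factor
  Q≈ : ∀ x → ⟦ divisorProd D d' ⟧ x ≡ (x ^ G - + 1) * ⟦ T ⟧ x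
  Q≈ x = begin
    ⟦ divisorProd D d' ⟧ x          ≡⟨ proj₂ factor x ⟩
    ⟦ divisorProd G d' ⟧ x * ⟦ T ⟧ x ≡⟨ cong (λ p → ⟦ p ⟧ x * ⟦ T ⟧ x)
                                          (trans (cong (divisorProd G) (sym (ℕP.m+[n∸m]≡n g'<d')))
                                                 (divisorProd-stable g' (d' ∸ G))) ⟩
    ⟦ divisorProd G G ⟧ x * ⟦ T ⟧ x  ≡⟨ cong (_* ⟦ T ⟧ x) (x^N-1≡divisorProd cyc-g x) ⟨
    (x ^ G - + 1) * ⟦ T ⟧ x          ∎
  on-samples : ∀ t → ⟦ geoₚ G q ⟧ (sample t) ≡ ⟦ Φ D *ₚ T ⟧ (sample t)
  on-samples t = ℤP.*-cancelˡ-≡ (y ^ G - + 1) _ _ {{ℤ.≢-nonZero (sample^-1≢0 t g')}} (begin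
    (y ^ G - + 1) * ⟦ geoₚ G q ⟧ y               ≡⟨ eval-geoₚ G q y ⟨
    y ^ (G ℕ.* q) - + 1                         ≡⟨ cong (λ n → y ^ n - + 1) (trans (ℕP.*-comm G q) (sym D≡qG)) ⟩
    y ^ D - + 1                                 ≡⟨ factorisation cyc-d y ⟩
    ⟦ Φ D ⟧ y * ⟦ divisorProd D d' ⟧ y          ≡⟨ cong (⟦ Φ D ⟧ y *_) (Q≈ y) ⟩
    ⟦ Φ D ⟧ y * ((y ^ G - + 1) * ⟦ T ⟧ y)       ≡⟨ swap (⟦ Φ D ⟧ y) (y ^ G - + 1) (⟦ T ⟧ y) ⟩
    (y ^ G - + 1) * (⟦ Φ D ⟧ y * ⟦ T ⟧ y)       ≡⟨ cong ((y ^ G - + 1) *_) (eval-*ₚ (Φ D) T y) ⟨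
    (y ^ G - + 1) * ⟦ Φ D *ₚ T ⟧ y              ∎)
    where
    y = sample t
    swap : ∀ a b c → a * (b * c) ≡ b * (a * c)
    swap = solve-∀

CoprimeOverℚ : Poly → Poly → Set
CoprimeOverℚ f g = Σ[ U ∈ Poly ] Σ[ V ∈ Poly ] Σ[ c ∈ ℤ ] c ≢ + 0 × (∀ x → ⟦ f ⟧ x * ⟦ U ⟧ x + ⟦ g ⟧ x * ⟦ V ⟧ x ≡ c)

CoprimeOverℚ-oneₚ : ∀ f → CoprimeOverℚ f oneₚ
CoprimeOverℚ-oneₚ f = [] , oneₚ , + 1 , (λ ()) , λ x → begin
  ⟦ f ⟧ x * + 0 + ⟦ oneₚ ⟧ x * ⟦ oneₚ ⟧ x ≡⟨ cong₂ (λ u v → u + v * v) (ℤP.*-zeroʳ (⟦ f ⟧ x)) (eval-oneₚ x) ⟩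
  + 1                                     ∎

CoprimeOverℚ-≗ : ∀ f g g′ → ⟦ g ⟧ ≗ ⟦ g′ ⟧ → CoprimeOverℚ f g → CoprimeOverℚ f g′
CoprimeOverℚ-≗ f g g′ g≈g′ (U , V , c , c≢0 , eq) =
  U , V , c , c≢0 , λ x → trans (cong (λ u → ⟦ f ⟧ x * ⟦ U ⟧ x + u * ⟦ V ⟧ x) (sym (g≈g′ x))) (eq x)

-- c₁ c₂ = f U₁ c₂ + g V₁ (f U₂ + h V₂)
CoprimeOverℚ-*ₚ : ∀ f g h → CoprimeOverℚ f g → CoprimeOverℚ f h → CoprimeOverℚ f (g *ₚ h)
CoprimeOverℚ-*ₚ f g h (U₁ , V₁ , c₁ , c₁≢0 , eq₁) (U₂ , V₂ , c₂ , c₂≢0 , eq₂) =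
  c₂ ·ₚ U₁ +ₚ g *ₚ V₁ *ₚ U₂ , V₁ *ₚ V₂ , c₁ * c₂ , c₁c₂≢0 , λ x → begin
    ⟦ f ⟧ x * ⟦ c₂ ·ₚ U₁ +ₚ g *ₚ V₁ *ₚ U₂ ⟧ x + ⟦ g *ₚ h ⟧ x * ⟦ V₁ *ₚ V₂ ⟧ x
      ≡⟨ cong₂ (λ u v → ⟦ f ⟧ x * u + v) (eval-U x) (cong₂ _*_ (eval-*ₚ g h x) (eval-*ₚ V₁ V₂ x)) ⟩
    ⟦ f ⟧ x * (c₂ * ⟦ U₁ ⟧ x + ⟦ g ⟧ x * ⟦ V₁ ⟧ x * ⟦ U₂ ⟧ x) + ⟦ g ⟧ x * ⟦ h ⟧ x * (⟦ V₁ ⟧ x * ⟦ V₂ ⟧ x)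
      ≡⟨ expand (⟦ f ⟧ x) (⟦ g ⟧ x) (⟦ h ⟧ x) (⟦ U₁ ⟧ x) (⟦ V₁ ⟧ x) (⟦ U₂ ⟧ x) (⟦ V₂ ⟧ x) c₂ ⟩
    (⟦ f ⟧ x * ⟦ U₁ ⟧ x + ⟦ g ⟧ x * ⟦ V₁ ⟧ x) * c₂ + ⟦ g ⟧ x * ⟦ V₁ ⟧ x * (⟦ f ⟧ x * ⟦ U₂ ⟧ x + ⟦ h ⟧ x * ⟦ V₂ ⟧ x - c₂)
      ≡⟨ cong₂ (λ u v → u * c₂ + ⟦ g ⟧ x * ⟦ V₁ ⟧ x * (v - c₂)) (eq₁ x) (eq₂ x) ⟩
    c₁ * c₂ + ⟦ g ⟧ x * ⟦ V₁ ⟧ x * (c₂ - c₂)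
      ≡⟨ cancel c₁ c₂ (⟦ g ⟧ x * ⟦ V₁ ⟧ x) ⟩
    c₁ * c₂ ∎
  where
  c₁c₂≢0 : c₁ * c₂ ≢ + 0
  c₁c₂≢0 eq = [ c₁≢0 , c₂≢0 ]′ (ℤP.i*j≡0⇒i≡0∨j≡0 c₁ eq)
  eval-U : ∀ x → ⟦ c₂ ·ₚ U₁ +ₚ g *ₚ V₁ *ₚ U₂ ⟧ x ≡ c₂ * ⟦ U₁ ⟧ x + ⟦ g ⟧ x * ⟦ V₁ ⟧ x * ⟦ U₂ ⟧ x
  eval-U x rewrite eval-+ₚ (c₂ ·ₚ U₁) (g *ₚ V₁ *ₚ U₂) x | eval-·ₚ c₂ U₁ x
                 | eval-*ₚ (g *ₚ V₁) U₂ x | eval-*ₚ g V₁ x = refl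
  expand : ∀ f g h u₁ v₁ u₂ v₂ c₂ →
    f * (c₂ * u₁ + g * v₁ * u₂) + g * h * (v₁ * v₂) ≡ (f * u₁ + g * v₁) * c₂ + g * v₁ * (f * u₂ + h * v₂ - c₂)
  expand = solve-∀
  cancel : ∀ c₁ c₂ w → c₁ * c₂ + w * (c₂ - c₂) ≡ c₁ * c₂
  cancel = solve-∀

-- Euclid's lemma: c G = f (U G + V R), so the division of G by f is exact.
CoprimeOverℚ-∣ : ∀ f g G R → Monic f → CoprimeOverℚ f g → (∀ x → ⟦ g ⟧ x * ⟦ G ⟧ x ≡ ⟦ f ⟧ x * ⟦ R ⟧ x) →
                 ∀ x → ⟦ G ⟧ x ≡ ⟦ quotMonic G f ⟧ x * ⟦ f ⟧ x
CoprimeOverℚ-∣ f g G R f-monic (U , V , c , c≢0 , eq) gG≈fR = quotMonic-exact G f (U *ₚ G +ₚ V *ₚ R) c f-monic c≢0 λ x → begin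
  c * ⟦ G ⟧ x                                                ≡⟨ cong (_* ⟦ G ⟧ x) (eq x) ⟨
  (⟦ f ⟧ x * ⟦ U ⟧ x + ⟦ g ⟧ x * ⟦ V ⟧ x) * ⟦ G ⟧ x         ≡⟨ regroup (⟦ f ⟧ x) (⟦ g ⟧ x) (⟦ U ⟧ x) (⟦ V ⟧ x) (⟦ G ⟧ x) ⟩
  ⟦ f ⟧ x * (⟦ U ⟧ x * ⟦ G ⟧ x) + ⟦ V ⟧ x * (⟦ g ⟧ x * ⟦ G ⟧ x) ≡⟨ cong (λ u → ⟦ f ⟧ x * (⟦ U ⟧ x * ⟦ G ⟧ x) + ⟦ V ⟧ x * u) (gG≈fR x) ⟩
  ⟦ f ⟧ x * (⟦ U ⟧ x * ⟦ G ⟧ x) + ⟦ V ⟧ x * (⟦ f ⟧ x * ⟦ R ⟧ x) ≡⟨ factor (⟦ f ⟧ x) (⟦ U ⟧ x) (⟦ V ⟧ x) (⟦ G ⟧ x) (⟦ R ⟧ x) ⟩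
  ⟦ f ⟧ x * (⟦ U ⟧ x * ⟦ G ⟧ x + ⟦ V ⟧ x * ⟦ R ⟧ x)         ≡⟨ cong (⟦ f ⟧ x *_) (eval-W x) ⟨
  ⟦ f ⟧ x * ⟦ U *ₚ G +ₚ V *ₚ R ⟧ x                           ∎
  where
  regroup : ∀ f g u v G → (f * u + g * v) * G ≡ f * (u * G) + v * (g * G)
  regroup = solve-∀
  factor : ∀ f u v G R → f * (u * G) + v * (f * R) ≡ f * (u * G + v * R)
  factor = solve-∀
  eval-W : ∀ x → ⟦ U *ₚ G +ₚ V *ₚ R ⟧ x ≡ ⟦ U ⟧ x * ⟦ G ⟧ x + ⟦ V ⟧ x * ⟦ R ⟧ x
  eval-W x = trans (eval-+ₚ (U *ₚ G) (V *ₚ R) x) (cong₂ _+_ (eval-*ₚ U G x) (eval-*ₚ V R x))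

private
  coprime-combination : ∀ φD φE T geo q W U₁ V₁ QD QE XD XE Xg →
    geo ≡ φD * T → geo - q ≡ Xg * W → U₁ * XD + V₁ * XE ≡ Xg → XD ≡ φD * QD → XE ≡ φE * QE →
    φD * (T - W * U₁ * QD) + φE * - (W * V₁ * QE) ≡ q
  coprime-combination φD φE T geo q W U₁ V₁ QD QE XD XE Xg geo≡ geo-q≡ bézout XD≡ XE≡ = begin
    φD * (T - W * U₁ * QD) + φE * - (W * V₁ * QE)     ≡⟨ regroup φD φE T W U₁ V₁ QD QE ⟩
    φD * T - W * (U₁ * (φD * QD) + V₁ * (φE * QE))   ≡⟨ cong₂ (λ a b → a - W * b) (sym geo≡)
                                                           (trans (cong₂ (λ a b → U₁ * a + V₁ * b) (sym XD≡) (sym XE≡)) bézout) ⟩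
    geo - W * Xg                                      ≡⟨ cong (_-_ geo) (trans (ℤP.*-comm W Xg) (sym geo-q≡)) ⟩
    geo - (geo - q)                                   ≡⟨ cancel geo q ⟩
    q                                                 ∎
    where
    regroup : ∀ φD φE T W U₁ V₁ QD QE →
      φD * (T - W * U₁ * QD) + φE * - (W * V₁ * QE) ≡ φD * T - W * (U₁ * (φD * QD) + V₁ * (φE * QE))
    regroup = solve-∀
    cancel : ∀ a b → a - (a - b) ≡ b
    cancel = solve-∀

  -- With G = gcd(D, E) = D / q:  q = geoₚ G q - (x^G - 1) Σgeoₚ G q, where Φ_D divides geoₚ G q
  -- and x^G - 1 is a combination of x^D - 1 and x^E - 1.
  Φ-coprime-by-gcd : ∀ d' e' g' q → e' ℕ.< d' → (∀ {m} → m ℕ.≤ d' → CyclotomicIdentity m) →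
    gcd (suc d') (suc e') ≡ suc g' → suc d' ≡ q ℕ.* suc g' → CoprimeOverℚ (Φ (suc d')) (Φ (suc e'))
  Φ-coprime-by-gcd d' e' g' q e'<d' cyc G≡ D≡qG = U , V , + q , q≢0 , λ x → begin
      ⟦ Φ D ⟧ x * ⟦ U ⟧ x + ⟦ Φ E ⟧ x * ⟦ V ⟧ x
        ≡⟨ cong₂ (λ u v → ⟦ Φ D ⟧ x * u + ⟦ Φ E ⟧ x * v) (eval-U x) (eval-V x) ⟩
      ⟦ Φ D ⟧ x * (⟦ T ⟧ x - ⟦ W ⟧ x * ⟦ U₁ ⟧ x * ⟦ QD ⟧ x) + ⟦ Φ E ⟧ x * - (⟦ W ⟧ x * ⟦ V₁ ⟧ x * ⟦ QE ⟧ x)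
        ≡⟨ coprime-combination (⟦ Φ D ⟧ x) (⟦ Φ E ⟧ x) (⟦ T ⟧ x) (⟦ geoₚ G q ⟧ x) (+ q) (⟦ W ⟧ x)
             (⟦ U₁ ⟧ x) (⟦ V₁ ⟧ x) (⟦ QD ⟧ x) (⟦ QE ⟧ x) (x ^ D - + 1) (x ^ E - + 1) (x ^ G - + 1)
             (proj₂ geo-factor x) (eval-Σgeoₚ G q x)
             (trans (proj₂ (proj₂ bézout) x) (cong (λ n → x ^ n - + 1) G≡))
             (factorisation (cyc ℕP.≤-refl) x) (factorisation (cyc (ℕP.<⇒≤ e'<d')) x) ⟩
      + q ∎
    where
    D = suc d'
    E = suc e'
    G = suc g'
    g'<d' : g' ℕ.< d'
    g'<d' = ℕP.≤-trans (subst (ℕ._≤ E) G≡ (gcd[m,n]≤n D E)) e'<d'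
    geo-factor = Φ-∣-geo d' g' q (cyc ℕP.≤-refl) (cyc (ℕP.<⇒≤ g'<d')) D≡qG g'<d'
    T = proj₁ geo-factor
    bézout = x^gcd-1-combination D E
    U₁ = proj₁ bézout
    V₁ = proj₁ (proj₂ bézout)
    W = Σgeoₚ G q
    QD = divisorProd D d'
    QE = divisorProd E e'
    U = T -ₚ W *ₚ U₁ *ₚ QD
    V = negₚ (W *ₚ V₁ *ₚ QE)
    q≢0 : + q ≢ + 0
    q≢0 q≡0 = ℕP.0≢1+n (sym (trans D≡qG (cong (ℕ._* G) (ℤP.+-injective q≡0))))
    eval-U : ∀ x → ⟦ U ⟧ x ≡ ⟦ T ⟧ x - ⟦ W ⟧ x * ⟦ U₁ ⟧ x * ⟦ QD ⟧ x
    eval-U x rewrite eval--ₚ T (W *ₚ U₁ *ₚ QD) x | eval-*ₚ (W *ₚ U₁) QD x | eval-*ₚ W U₁ x = refl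
    eval-V : ∀ x → ⟦ V ⟧ x ≡ - (⟦ W ⟧ x * ⟦ V₁ ⟧ x * ⟦ QE ⟧ x)
    eval-V x rewrite eval-negₚ (W *ₚ V₁ *ₚ QE) x | eval-*ₚ (W *ₚ V₁) QE x | eval-*ₚ W V₁ x = refl

Φ-coprime : ∀ d' e' → e' ℕ.< d' → (∀ {m} → m ℕ.≤ d' → CyclotomicIdentity m) →
            CoprimeOverℚ (Φ (suc d')) (Φ (suc e'))
Φ-coprime d' e' e'<d' cyc with gcd (suc d') (suc e') in G≡ | gcd[m,n]∣m (suc d') (suc e')
... | zero   | _              = contradiction G≡ (gcd[m,n]≢0 (suc d') (suc e') (inj₁ λ ()))
... | suc g' | divides q D≡qG = Φ-coprime-by-gcd d' e' g' q e'<d' cyc G≡ D≡qG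

Φ-coprime-divisorProd : ∀ N d' j → j ℕ.≤ d' → (∀ {m} → m ℕ.≤ d' → CyclotomicIdentity m) →
                        CoprimeOverℚ (Φ (suc d')) (divisorProd N j)
Φ-coprime-divisorProd N d' zero    _     cyc = CoprimeOverℚ-oneₚ (Φ (suc d'))
Φ-coprime-divisorProd N d' (suc j) j<d' cyc with suc j ∣? N
... | yes ∣N = CoprimeOverℚ-≗ (Φ (suc d')) (divisorProd N j *ₚ Φ (suc j)) (divisorProd N (suc j)) (λ x → trans (eval-*ₚ (divisorProd N j) (Φ (suc j)) x) (sym (divisorProd-∣ N j ∣N x)))
                 (CoprimeOverℚ-*ₚ (Φ (suc d')) (divisorProd N j) (Φ (suc j)) (Φ-coprime-divisorProd N d' j (ℕP.<⇒≤ j<d') cyc) (Φ-coprime d' j j<d' cyc))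
... | no ∤N  = subst (CoprimeOverℚ (Φ (suc d'))) (sym (divisorProd-∤ N j ∤N))
                 (Φ-coprime-divisorProd N d' j (ℕP.<⇒≤ j<d') cyc)

private
  xᴺ-1-multiple : ∀ n j → j ℕ.≤ n → (∀ {m} → m ℕ.< n → CyclotomicIdentity m) →
                  Σ[ G ∈ Poly ] ∀ x → ⟦ xⁿ-1 (suc n) ⟧ x ≡ ⟦ divisorProd (suc n) j ⟧ x * ⟦ G ⟧ x
  xᴺ-1-multiple n zero    _   cyc = xⁿ-1 (suc n) , λ x →
    sym (trans (cong (_* ⟦ xⁿ-1 (suc n) ⟧ x) (eval-oneₚ x)) (ℤP.*-identityˡ (⟦ xⁿ-1 (suc n) ⟧ x)))
  xᴺ-1-multiple n (suc j) j<n cyc with xᴺ-1-multiple n j (ℕP.<⇒≤ j<n) cyc | suc j ∣? suc n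
  ... | G , F≈PG | no ∤N = G , λ x → trans (F≈PG x) (cong (λ p → ⟦ p ⟧ x * ⟦ G ⟧ x) (sym (divisorProd-∤ (suc n) j ∤N)))
  ... | G , F≈PG | yes (divides q N≡qD) = quotMonic G (Φ D) , λ x → begin
    ⟦ F ⟧ x                                                   ≡⟨ F≈PG x ⟩
    ⟦ divisorProd N j ⟧ x * ⟦ G ⟧ x                           ≡⟨ cong (⟦ divisorProd N j ⟧ x *_) (G≈qΦ x) ⟩
    ⟦ divisorProd N j ⟧ x * (⟦ quotMonic G (Φ D) ⟧ x * ⟦ Φ D ⟧ x)
                                                              ≡⟨ swap (⟦ divisorProd N j ⟧ x) (⟦ quotMonic G (Φ D) ⟧ x) (⟦ Φ D ⟧ x) ⟩
    ⟦ divisorProd N j ⟧ x * ⟦ Φ D ⟧ x * ⟦ quotMonic G (Φ D) ⟧ x ≡⟨ cong (_* ⟦ quotMonic G (Φ D) ⟧ x) (divisorProd-∣ N j (divides q N≡qD) x) ⟨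
    ⟦ divisorProd N (suc j) ⟧ x * ⟦ quotMonic G (Φ D) ⟧ x     ∎
    where
    N = suc n
    D = suc j
    F = xⁿ-1 N
    cyc-D = cyc j<n
    F≈ΦR : ∀ x → ⟦ F ⟧ x ≡ ⟦ Φ D ⟧ x * ⟦ divisorProd D j *ₚ geoₚ D q ⟧ x
    F≈ΦR x = begin
      ⟦ F ⟧ x                                               ≡⟨ eval-xⁿ-1 N x ⟩
      x ^ N - + 1                                           ≡⟨ cong (λ m → x ^ m - + 1) (trans N≡qD (ℕP.*-comm q D)) ⟩
      x ^ (D ℕ.* q) - + 1                                   ≡⟨ eval-geoₚ D q x ⟩
      (x ^ D - + 1) * ⟦ geoₚ D q ⟧ x                        ≡⟨ cong (_* ⟦ geoₚ D q ⟧ x) (factorisation cyc-D x) ⟩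
      ⟦ Φ D ⟧ x * ⟦ divisorProd D j ⟧ x * ⟦ geoₚ D q ⟧ x    ≡⟨ ℤP.*-assoc (⟦ Φ D ⟧ x) _ _ ⟩
      ⟦ Φ D ⟧ x * (⟦ divisorProd D j ⟧ x * ⟦ geoₚ D q ⟧ x)  ≡⟨ cong (⟦ Φ D ⟧ x *_) (eval-*ₚ (divisorProd D j) (geoₚ D q) x) ⟨
      ⟦ Φ D ⟧ x * ⟦ divisorProd D j *ₚ geoₚ D q ⟧ x         ∎
    G≈qΦ : ∀ x → ⟦ G ⟧ x ≡ ⟦ quotMonic G (Φ D) ⟧ x * ⟦ Φ D ⟧ x
    G≈qΦ = CoprimeOverℚ-∣ (Φ D) (divisorProd N j) G (divisorProd D j *ₚ geoₚ D q) (Φ-monic cyc-D)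
             (Φ-coprime-divisorProd N j j ℕP.≤-refl (λ m≤j → cyc (ℕP.≤-<-trans m≤j j<n)))
             (λ x → trans (sym (F≈PG x)) (F≈ΦR x))
    swap : ∀ a b c → a * (b * c) ≡ a * c * b
    swap = solve-∀

  -- Φ_N is defined as the quotient of x^N - 1 by Q = ∏_{d ∣ N, d < N} Φ_d; it is exact since the
  -- pairwise coprime Φ_d successively divide x^N - 1.
  cyclotomic-step : ∀ n → (∀ {m} → m ℕ.< n → CyclotomicIdentity m) → CyclotomicIdentity n
  cyclotomic-step n cyc = record
    { Φ-monic       = Monic-factor F (Φ N) Q (Monic-xⁿ-1 n) Q-monic F≈ΦQ
    ; factorisation = λ x → trans (sym (eval-xⁿ-1 N x)) (F≈ΦQ x)
    }
    where
    N = suc n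
    F = xⁿ-1 N
    Q = divisorProd N n
    Q-monic : Monic Q
    Q-monic = Monic-divisorProd N n (λ d d<n → Φ-monic (cyc d<n))
    multiple = xᴺ-1-multiple n n ℕP.≤-refl cyc
    F≈ΦQ : ∀ x → ⟦ F ⟧ x ≡ ⟦ Φ N ⟧ x * ⟦ Q ⟧ x
    F≈ΦQ x = begin
      ⟦ F ⟧ x                       ≡⟨ quotMonic-exact F Q (proj₁ multiple) (+ 1) Q-monic (λ ())
                                         (λ x → trans (ℤP.*-identityˡ (⟦ F ⟧ x)) (proj₂ multiple x)) x ⟩
      ⟦ quotMonic F Q ⟧ x * ⟦ Q ⟧ x ≡⟨ cong (λ p → ⟦ p ⟧ x * ⟦ Q ⟧ x) (Φ-suc n) ⟨
      ⟦ Φ N ⟧ x * ⟦ Q ⟧ x           ∎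

cyclotomic : ∀ n → CyclotomicIdentity n
cyclotomic = <-rec CyclotomicIdentity cyclotomic-step

module _ {p : ℕ} (p-prime : Prime p) where

  prime-∣ℤ-* : ∀ a b → + p ∣ℤ a * b → + p ∣ℤ a ⊎ + p ∣ℤ b
  prime-∣ℤ-* a b p∣ab = Sum.map ℤD.∣ᵤ⇒∣ ℤD.∣ᵤ⇒∣
    (euclidsLemma ∣ a ∣ ∣ b ∣ p-prime (subst (p ℕD.∣_) (ℤP.abs-* a b) (ℤD.∣⇒∣ᵤ p∣ab)))

  prime-∣ℤ-^ : ∀ a n → + p ∣ℤ a ^ n → + p ∣ℤ a
  prime-∣ℤ-^ a zero    p∣1   = contradiction (ℕD.∣1⇒≡1 (ℤD.∣⇒∣ᵤ p∣1)) (ℕ.nonTrivial⇒≢1 {{prime⇒nonTrivial p-prime}})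
  prime-∣ℤ-^ a (suc n) p∣aⁿ⁺¹ = fromInj₁ (prime-∣ℤ-^ a n) (prime-∣ℤ-* a (a ^ n) p∣aⁿ⁺¹)

  prime-∤ℤ-unit : ∀ u → ∣ u ∣ ≡ 1 → ¬ + p ∣ℤ u
  prime-∤ℤ-unit u ∣u∣≡1 p∣u =
    ℕ.nonTrivial⇒≢1 {{prime⇒nonTrivial p-prime}} (ℕD.∣1⇒≡1 (subst (p ℕD.∣_) ∣u∣≡1 (ℤD.∣⇒∣ᵤ p∣u)))

∣ℤ-eval : ∀ d f → (∀ i → d ∣ℤ coeff f i) → ∀ x → d ∣ℤ ⟦ f ⟧ x
∣ℤ-eval d []      _      x = ℤD.∣ᵤ⇒∣ (∣ d ∣ ℕD.∣0)
∣ℤ-eval d (a ∷ f) d∣coeff x = ℤD.∣m∣n⇒∣m+n (d∣coeff 0) (ℤD.∣n⇒∣m*n x (∣ℤ-eval d f (d∣coeff ∘ suc) x))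

-- Fermat's little theorem

binomialₚ : ℕ → Poly
binomialₚ n = ((+ 1) +ζ) ^ₚ n

binom : ℕ → ℕ → ℤ
binom n i = coeff (binomialₚ n) i

binom-zero : ∀ n → binom n 0 ≡ + 1
binom-zero zero    = refl
binom-zero (suc n) = trans (coeff-*ₚ-zero (+ 1) (+ 1 ∷ []) (binomialₚ n)) (cong (_*_ (+ 1)) (binom-zero n))

binom-pascal : ∀ n i → binom (suc n) (suc i) ≡ binom n (suc i) + binom n i
binom-pascal n i = begin
  binom (suc n) (suc i)                                  ≡⟨ coeff-*ₚ-suc (+ 1) (+ 1 ∷ []) (binomialₚ n) i ⟩
  + 1 * binom n (suc i) + coeff ((+ 1 ∷ []) *ₚ binomialₚ n) i ≡⟨ cong₂ _+_ (ℤP.*-identityˡ (binom n (suc i)))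
                                                                  (coeff-*ₚ-const (+ 1) [] (binomialₚ n) (λ _ _ → refl) i) ⟩
  binom n (suc i) + + 1 * binom n i                      ≡⟨ cong (_+_ (binom n (suc i))) (ℤP.*-identityˡ (binom n i)) ⟩
  binom n (suc i) + binom n i                            ∎

binomialₚ-degree : ∀ n → DegreeBelow (binomialₚ n) (suc n) × binom n n ≡ + 1
binomialₚ-degree zero    = (λ { (suc i) _ → refl }) , refl
binomialₚ-degree (suc n) =
  let degree , top = *ₚ-degree (+ 1 ∷ + 1 ∷ []) (binomialₚ n) 1 n linear (proj₁ (binomialₚ-degree n))
  in degree , trans top (cong (_*_ (+ 1)) (proj₂ (binomialₚ-degree n)))
  where
  linear : DegreeBelow (+ 1 ∷ + 1 ∷ []) 2
  linear (suc zero)    (s≤s ())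
  linear (suc (suc i)) _ = refl

private
  absorption-step : ∀ J N b₂ b₁ c₁ c₀ → (+ 1 + J) * b₂ ≡ N * c₁ → J * b₁ ≡ N * c₀ → b₁ ≡ c₁ + c₀ →
                    (+ 1 + J) * (b₂ + b₁) ≡ (+ 1 + N) * b₁
  absorption-step J N b₂ b₁ c₁ c₀ eq₂ eq₁ pascal = begin
    (+ 1 + J) * (b₂ + b₁)              ≡⟨ expand J b₂ b₁ ⟩
    (+ 1 + J) * b₂ + J * b₁ + b₁        ≡⟨ cong₂ (λ u v → u + v + b₁) eq₂ eq₁ ⟩
    N * c₁ + N * c₀ + b₁                ≡⟨ cong (_+ b₁) (ℤP.*-distribˡ-+ N c₁ c₀) ⟨
    N * (c₁ + c₀) + b₁                  ≡⟨ cong (λ u → N * u + b₁) pascal ⟨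
    N * b₁ + b₁                         ≡⟨ collect N b₁ ⟩
    (+ 1 + N) * b₁                      ∎
    where
    expand : ∀ J b₂ b₁ → (+ 1 + J) * (b₂ + b₁) ≡ (+ 1 + J) * b₂ + J * b₁ + b₁
    expand = solve-∀
    collect : ∀ N b → N * b + b ≡ (+ 1 + N) * b
    collect = solve-∀

binom-absorption : ∀ n i → + suc i * binom (suc n) (suc i) ≡ + suc n * binom n i
binom-absorption zero    zero    = refl
binom-absorption zero    (suc i) = trans (ℤP.*-zeroʳ (+ suc (suc i))) (sym (ℤP.*-zeroʳ (+ 1)))
binom-absorption (suc n) zero    = begin
  + 1 * binom (suc (suc n)) 1               ≡⟨ ℤP.*-identityˡ _ ⟩
  binom (suc (suc n)) 1                     ≡⟨ binom-pascal (suc n) 0 ⟩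
  binom (suc n) 1 + binom (suc n) 0         ≡⟨ cong₂ _+_ (trans (sym (ℤP.*-identityˡ _)) (binom-absorption n 0)) (binom-zero (suc n)) ⟩
  + suc n * binom n 0 + + 1                 ≡⟨ cong (λ b → + suc n * b + + 1) (binom-zero n) ⟩
  + suc n * + 1 + + 1                       ≡⟨ cong (_+ + 1) (ℤP.*-identityʳ (+ suc n)) ⟩
  + suc n + + 1                             ≡⟨ ℤP.+-comm (+ suc n) (+ 1) ⟩
  + suc (suc n)                             ≡⟨ ℤP.*-identityʳ _ ⟨
  + suc (suc n) * + 1                       ≡⟨ cong (_*_ (+ suc (suc n))) (binom-zero (suc n)) ⟨
  + suc (suc n) * binom (suc n) 0           ∎
binom-absorption (suc n) (suc i) = begin
  + suc (suc i) * binom (suc (suc n)) (suc (suc i))                ≡⟨ cong (_*_ (+ suc (suc i))) (binom-pascal (suc n) (suc i)) ⟩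
  + suc (suc i) * (binom (suc n) (suc (suc i)) + binom (suc n) (suc i))
      ≡⟨ absorption-step (+ suc i) (+ suc n) _ _ (binom n (suc i)) (binom n i)
           (binom-absorption n (suc i)) (binom-absorption n i) (binom-pascal n i) ⟩
  + suc (suc n) * binom (suc n) (suc i)                            ∎

prime-∣-binom : ∀ {p} → Prime p → ∀ i → 0 ℕ.< i → i ℕ.< p → + p ∣ℤ binom p i
prime-∣-binom {suc p′} p-prime (suc i) _ i<p =
  fromInj₂ (λ p∣i → contradiction (ℕD.∣⇒≤ (ℤD.∣⇒∣ᵤ p∣i)) (ℕP.<⇒≱ i<p))
    (prime-∣ℤ-* p-prime (+ suc i) (binom (suc p′) (suc i))
      (subst (+ suc p′ ∣ℤ_) (sym (binom-absorption p′ i)) (ℤD.∣m⇒∣m*n (binom p′ i) ℤD.∣-refl)))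

0^prime : ∀ {p} → Prime p → (+ 0) ^ p ≡ + 0
0^prime {zero}   p-prime = contradiction refl (ℕ.≢-nonZero⁻¹ 0 {{prime⇒nonZero p-prime}})
0^prime {suc p′} _       = ℤP.*-zeroˡ ((+ 0) ^ p′)

frobeniusₚ : ℕ → Poly
frobeniusₚ p = binomialₚ p -ₚ oneₚ -ₚ monoₚ (+ 1) p

private
  ∣ℤ0 : ∀ {d} → d ∣ℤ + 0
  ∣ℤ0 {d} = ℤD.∣ᵤ⇒∣ (∣ d ∣ ℕD.∣0)

coeff-frobeniusₚ : ∀ p i → coeff (frobeniusₚ p) i ≡ binom p i - coeff oneₚ i - coeff (monoₚ (+ 1) p) i
coeff-frobeniusₚ p i rewrite coeff--ₚ (binomialₚ p -ₚ oneₚ) (monoₚ (+ 1) p) i | coeff--ₚ (binomialₚ p) oneₚ i = refl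

prime-∣-coeff-frobeniusₚ : ∀ {p} → Prime p → ∀ i → + p ∣ℤ coeff (frobeniusₚ p) i
prime-∣-coeff-frobeniusₚ {p} p-prime i rewrite coeff-frobeniusₚ p i with ℕP.<-cmp i p
... | tri< i<p _ _ rewrite coeff-monoₚ-below (+ 1) p i i<p with i
...   | zero  rewrite binom-zero p = ∣ℤ0
...   | suc j = subst (+ p ∣ℤ_) (sym (ℤP.+-identityʳ _)) (subst (+ p ∣ℤ_) (sym (ℤP.+-identityʳ _))
                  (prime-∣-binom p-prime (suc j) (s≤s z≤n) i<p))
prime-∣-coeff-frobeniusₚ {suc p′} p-prime i | tri≈ _ refl _
  rewrite proj₂ (binomialₚ-degree (suc p′)) | coeff-monoₚ-top (+ 1) (suc p′) = ∣ℤ0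
prime-∣-coeff-frobeniusₚ {p} p-prime i | tri> _ _ p<i
  rewrite proj₁ (binomialₚ-degree p) i p<i | monoₚ-degree (+ 1) p i p<i with i | p<i
... | suc j | _ = ∣ℤ0

eval-frobeniusₚ : ∀ p x → ⟦ frobeniusₚ p ⟧ x ≡ (+ 1 + x) ^ p - + 1 - x ^ p
eval-frobeniusₚ p x
  rewrite eval--ₚ (binomialₚ p -ₚ oneₚ) (monoₚ (+ 1) p) x | eval--ₚ (binomialₚ p) oneₚ x
        | eval-^ₚ ((+ 1) +ζ) p x | eval-+ζ (+ 1) x | eval-oneₚ x | eval-monoₚ (+ 1) p x
        | ℤP.*-identityˡ (x ^ p) = refl

frobenius : ∀ {p} → Prime p → ∀ x → + p ∣ℤ (+ 1 + x) ^ p - + 1 - x ^ p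
frobenius {p} p-prime x = subst (+ p ∣ℤ_) (eval-frobeniusₚ p x)
  (∣ℤ-eval (+ p) (frobeniusₚ p) (prime-∣-coeff-frobeniusₚ p-prime) x)

module _ {p : ℕ} (p-prime : Prime p) where

  private
    fermat-succ : ∀ y → + p ∣ℤ y ^ p - y → + p ∣ℤ (+ 1 + y) ^ p - (+ 1 + y)
    fermat-succ y p∣ = subst (+ p ∣ℤ_) (shift y ((+ 1 + y) ^ p) (y ^ p)) (ℤD.∣m∣n⇒∣m+n (frobenius p-prime y) p∣)
      where
      shift : ∀ y P Q → (P - + 1 - Q) + (Q - y) ≡ P - (+ 1 + y)
      shift = solve-∀

    fermat-pred : ∀ y → + p ∣ℤ (+ 1 + y) ^ p - (+ 1 + y) → + p ∣ℤ y ^ p - y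
    fermat-pred y p∣ = subst (+ p ∣ℤ_) (unshift y ((+ 1 + y) ^ p) (y ^ p)) (ℤD.∣m∣n⇒∣m-n p∣ (frobenius p-prime y))
      where
      unshift : ∀ y P Q → (P - (+ 1 + y)) - (P - + 1 - Q) ≡ Q - y
      unshift = solve-∀

    fermat-+ : ∀ n → + p ∣ℤ (+ n) ^ p - + n
    fermat-+ zero    = subst (+ p ∣ℤ_) (sym (cong (_- + 0) (0^prime p-prime))) ∣ℤ0
    fermat-+ (suc n) = fermat-succ (+ n) (fermat-+ n)

    fermat-- : ∀ n → + p ∣ℤ -[1+ n ] ^ p - -[1+ n ]
    fermat-- zero    = fermat-pred -[1+ 0 ] (fermat-+ 0)
    fermat-- (suc n) = fermat-pred -[1+ suc n ] (fermat-- n)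

  fermat : ∀ x → + p ∣ℤ x ^ p - x
  fermat (+ n)    = fermat-+ n
  fermat -[1+ n ] = fermat-- n

fermat′ : ∀ {p} → Prime p → ∀ x → ¬ + p ∣ℤ x → + p ∣ℤ x ^ (p ∸ 1) - + 1
fermat′ {zero}   p-prime = contradiction refl (ℕ.≢-nonZero⁻¹ 0 {{prime⇒nonZero p-prime}})
fermat′ {suc p′} p-prime x p∤x = fromInj₂ (λ p∣x → contradiction p∣x p∤x)
  (prime-∣ℤ-* p-prime x (x ^ p′ - + 1) (subst (+ suc p′ ∣ℤ_) (factor x (x ^ p′)) (fermat p-prime x)))
  where
  factor : ∀ x y → x * y - x ≡ x * (y - + 1)
  factor = solve-∀

module _ {p : ℕ} (p-prime : Prime p) (k′ : ℕ) {m : ℤ} (p∣Φm : + p ∣ℤ ⟦ Φ (suc k′) ⟧ m) where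

  prime∣Φ⇒∣x^k-1 : + p ∣ℤ m ^ suc k′ - + 1
  prime∣Φ⇒∣x^k-1 = subst (+ p ∣ℤ_) (sym (factorisation (cyclotomic k′) m))
                     (ℤD.∣m⇒∣m*n (⟦ divisorProd (suc k′) k′ ⟧ m) p∣Φm)

  prime∣Φ⇒∤ : ¬ + p ∣ℤ m
  prime∣Φ⇒∤ p∣m = prime-∤ℤ-unit p-prime (+ 1) refl (subst (+ p ∣ℤ_) (cancel (m ^ suc k′))
    (ℤD.∣m∣n⇒∣m-n (ℤD.∣m⇒∣m*n (m ^ k′) p∣m) prime∣Φ⇒∣x^k-1))
    where
    cancel : ∀ y → y - (y - + 1) ≡ + 1
    cancel = solve-∀

  -- For a proper divisor d = k/q:  (m^k - 1)/(m^d - 1) ≡ q  (mod m^d - 1), and Φ_k(m) divides it.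
  prime∣Φ-proper-divisor : ∀ d → d ∣ suc k′ → d ℕ.< suc k′ → + p ∣ℤ m ^ d - + 1 → p ∣ suc k′
  prime∣Φ-proper-divisor zero     0∣k     _         _ = contradiction (ℕD.0∣⇒≡0 0∣k) ℕP.1+n≢0
  prime∣Φ-proper-divisor (suc d′) (divides q k≡qd) (s≤s d′<k′) p∣m^d-1 =
    ℕD.∣-trans (ℤD.∣⇒∣ᵤ p∣q) (divides (suc d′) (trans k≡qd (ℕP.*-comm q (suc d′))))
    where
    geo-factor = Φ-∣-geo k′ d′ q (cyclotomic k′) (cyclotomic d′) k≡qd d′<k′
    p∣geo : + p ∣ℤ ⟦ geoₚ (suc d′) q ⟧ m
    p∣geo = subst (+ p ∣ℤ_) (sym (proj₂ geo-factor m)) (ℤD.∣m⇒∣m*n (⟦ proj₁ geo-factor ⟧ m) p∣Φm)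
    p∣geo-q : + p ∣ℤ ⟦ geoₚ (suc d′) q ⟧ m - + q
    p∣geo-q = subst (+ p ∣ℤ_) (sym (eval-Σgeoₚ (suc d′) q m)) (ℤD.∣m⇒∣m*n (⟦ Σgeoₚ (suc d′) q ⟧ m) p∣m^d-1)
    p∣q : + p ∣ℤ + q
    p∣q = subst (+ p ∣ℤ_) (cancel (⟦ geoₚ (suc d′) q ⟧ m) (+ q)) (ℤD.∣m∣n⇒∣m-n p∣geo p∣geo-q)
      where
      cancel : ∀ a b → a - (a - b) ≡ b
      cancel = solve-∀

  -- The order of m modulo p is k; by Fermat it divides p - 1.
  prime∣Φ⇒k∣p-1 : ¬ p ∣ suc k′ → suc k′ ∣ p ∸ 1
  prime∣Φ⇒k∣p-1 p∤k with ℕP.m≤n⇒m<n∨m≡n (ℕD.∣⇒≤ (gcd[m,n]∣m (suc k′) (p ∸ 1)))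
  ... | inj₁ g<k = contradiction (prime∣Φ-proper-divisor g (gcd[m,n]∣m (suc k′) (p ∸ 1)) g<k p∣m^g-1) p∤k
    where
    g = gcd (suc k′) (p ∸ 1)
    combination = x^gcd-1-combination (suc k′) (p ∸ 1)
    p∣m^g-1 : + p ∣ℤ m ^ g - + 1
    p∣m^g-1 = subst (+ p ∣ℤ_) (proj₂ (proj₂ combination) m)
      (ℤD.∣m∣n⇒∣m+n (ℤD.∣n⇒∣m*n (⟦ proj₁ combination ⟧ m) prime∣Φ⇒∣x^k-1)
                    (ℤD.∣n⇒∣m*n (⟦ proj₁ (proj₂ combination) ⟧ m) (fermat′ p-prime m prime∣Φ⇒∤)))
  ... | inj₂ g≡k = subst (_∣ p ∸ 1) g≡k (gcd[m,n]∣n (suc k′) (p ∸ 1))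

-- Multiplicative dependence forces p ∣ a

≈[]⇒∣ℤ : ∀ {d} k f g → f ≈[ k ] g → ∀ x → d ∣ℤ ⟦ Φ k ⟧ x → d ∣ℤ ⟦ f ⟧ x - ⟦ g ⟧ x
≈[]⇒∣ℤ {d} k f g f≈g x d∣Φ = subst (d ∣ℤ_) q*Φ≡f-g (ℤD.∣n⇒∣m*n (⟦ quotMonic (f -ₚ g) (Φ k) ⟧ x) d∣Φ)
  where
  q*Φ≡f-g : ⟦ quotMonic (f -ₚ g) (Φ k) ⟧ x * ⟦ Φ k ⟧ x ≡ ⟦ f ⟧ x - ⟦ g ⟧ x
  q*Φ≡f-g = begin
    ⟦ quotMonic (f -ₚ g) (Φ k) ⟧ x * ⟦ Φ k ⟧ x                 ≡⟨ ℤP.+-identityʳ (⟦ quotMonic (f -ₚ g) (Φ k) ⟧ x * ⟦ Φ k ⟧ x) ⟨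
    ⟦ quotMonic (f -ₚ g) (Φ k) ⟧ x * ⟦ Φ k ⟧ x + ⟦ [] ⟧ x      ≡⟨ cong (λ r → ⟦ quotMonic (f -ₚ g) (Φ k) ⟧ x * ⟦ Φ k ⟧ x + ⟦ r ⟧ x) f≈g ⟨
    ⟦ quotMonic (f -ₚ g) (Φ k) ⟧ x * ⟦ Φ k ⟧ x + ⟦ remMonic (f -ₚ g) (Φ k) ⟧ x ≡⟨ quotMonic-eval (f -ₚ g) (Φ k) x ⟨
    ⟦ f -ₚ g ⟧ x                                               ≡⟨ eval--ₚ f g x ⟩
    ⟦ f ⟧ x - ⟦ g ⟧ x                                          ∎

∣ℤ-neg : ∀ {d x} → d ∣ℤ - x → d ∣ℤ x
∣ℤ-neg {d} {x} d∣-x = subst (d ∣ℤ_) (ℤP.neg-involutive x) (ℤD.∣m⇒∣-m d∣-x)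

module _ {p : ℕ} (p-prime : Prime p) (a : ℕ) where

  private
    relation : ℤ → ℤ → ℤ → ℤ → ℤ
    relation P Q u w = u ^ pos P * w ^ neg Q - w ^ pos Q * u ^ neg P

    ∣-a^⇒∣a : ∀ n → + p ∣ℤ (- + a) ^ n → + p ∣ℤ + a
    ∣-a^⇒∣a n p∣ = ∣ℤ-neg (prime-∣ℤ-^ p-prime (- + a) n p∣)

    -- α^P = β^Q with α = -m + ζ and β = -(m + a) + ζ, evaluated at ζ = m and at ζ = m + a.
    by-exponents : ∀ P Q → ¬ (P ≡ + 0 × Q ≡ + 0) →
      + p ∣ℤ relation P Q (+ 0) (- + a) → + p ∣ℤ relation P Q (+ a) (+ 0) → + p ∣ℤ + a
    by-exponents (+ suc i) Q _ at-m _ =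
      ∣-a^⇒∣a (pos Q) (∣ℤ-neg (subst (+ p ∣ℤ_) (vanish ((+ 0) ^ i) ((- + a) ^ neg Q) ((- + a) ^ pos Q)) at-m))
      where
      vanish : ∀ u v w → + 0 * u * v - w * + 1 ≡ - w
      vanish = solve-∀
    by-exponents -[1+ i ] Q _ at-m _ =
      ∣-a^⇒∣a (neg Q) (subst (+ p ∣ℤ_) (vanish ((+ 0) ^ i) ((- + a) ^ neg Q) ((- + a) ^ pos Q)) at-m)
      where
      vanish : ∀ u v w → + 1 * v - w * (+ 0 * u) ≡ v
      vanish = solve-∀
    by-exponents (+ zero) (+ zero)    P,Q≢0 _ _ = contradiction (refl , refl) P,Q≢0
    by-exponents (+ zero) (+ suc j)   _ _ at-m+a =
      contradiction (subst (+ p ∣ℤ_) (vanish ((+ 0) ^ j)) at-m+a) (prime-∤ℤ-unit p-prime (+ 1) refl)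
      where
      vanish : ∀ u → + 1 * + 1 - + 0 * u * + 1 ≡ + 1
      vanish = solve-∀
    by-exponents (+ zero) -[1+ j ]   _ _ at-m+a =
      contradiction (subst (+ p ∣ℤ_) (vanish ((+ 0) ^ j)) at-m+a) (prime-∤ℤ-unit p-prime (- + 1) refl)
      where
      vanish : ∀ u → + 1 * (+ 0 * u) - + 1 * + 1 ≡ - + 1
      vanish = solve-∀

  multDep⇒∣ : ∀ k m → MultDep k ((ℤ.- m) +ζ) ((ℤ.- (m + + a)) +ζ) →
              + p ∣ℤ ⟦ Φ k ⟧ m → + p ∣ℤ ⟦ Φ k ⟧ (m + + a) → + p ∣ℤ + a
  multDep⇒∣ k m (P , Q , P,Q≢0 , α^P≈β^Q) p∣Φm p∣Φm+a = by-exponents P Q P,Q≢0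
    (subst (+ p ∣ℤ_) (cong₂ (relation P Q) α[m] β[m]) (at m p∣Φm))
    (subst (+ p ∣ℤ_) (cong₂ (relation P Q) α[m+a] β[m+a]) (at (m + + a) p∣Φm+a))
    where
    α = (- m) +ζ
    β = (- (m + + a)) +ζ
    at : ∀ x → + p ∣ℤ ⟦ Φ k ⟧ x → + p ∣ℤ relation P Q (⟦ α ⟧ x) (⟦ β ⟧ x)
    at x p∣Φx = subst (+ p ∣ℤ_) (cong₂ _-_
        (trans (eval-*ₚ (α ^ₚ pos P) (β ^ₚ neg Q) x) (cong₂ _*_ (eval-^ₚ α (pos P) x) (eval-^ₚ β (neg Q) x)))
        (trans (eval-*ₚ (β ^ₚ pos Q) (α ^ₚ neg P) x) (cong₂ _*_ (eval-^ₚ β (pos Q) x) (eval-^ₚ α (neg P) x))))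
      (≈[]⇒∣ℤ k ((α ^ₚ pos P) *ₚ (β ^ₚ neg Q)) ((β ^ₚ pos Q) *ₚ (α ^ₚ neg P)) α^P≈β^Q x p∣Φx)
    α[m] : ⟦ α ⟧ m ≡ + 0
    α[m] = trans (eval-+ζ (- m) m) (ℤP.+-inverseˡ m)
    β[m] : ⟦ β ⟧ m ≡ - + a
    β[m] = trans (eval-+ζ (- (m + + a)) m) (shift m (+ a))
      where
      shift : ∀ m a → - (m + a) + m ≡ - a
      shift = solve-∀
    α[m+a] : ⟦ α ⟧ (m + + a) ≡ + a
    α[m+a] = trans (eval-+ζ (- m) (m + + a)) (shift m (+ a))
      where
      shift : ∀ m a → - m + (m + a) ≡ a
      shift = solve-∀
    β[m+a] : ⟦ β ⟧ (m + + a) ≡ + 0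
    β[m+a] = trans (eval-+ζ (- (m + + a)) (m + + a)) (ℤP.+-inverseˡ (m + + a))

binomial-difference : ∀ k′ m a → Σ[ T ∈ ℤ ] (m + a) ^ suc k′ - m ^ suc k′ ≡ a * (+ suc k′ * m ^ k′ + a * T)
binomial-difference zero     m a = + 0 , base m a
  where
  base : ∀ m a → (m + a) * + 1 - m * + 1 ≡ a * (+ 1 * + 1 + a * + 0)
  base = solve-∀
binomial-difference (suc k′) m a =
  let T , eq = binomial-difference k′ m a
  in + suc k′ * m ^ k′ + (m + a) * T , step m a (+ suc k′) ((m + a) ^ suc k′) (m ^ k′) T eq
  where
  step : ∀ m a K Y Z T → Y - m * Z ≡ a * (K * Z + a * T) →
         (m + a) * Y - m * (m * Z) ≡ a * ((+ 1 + K) * (m * Z) + a * (K * Z + (m + a) * T))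
  step m a K Y Z T eq = begin
    (m + a) * Y - m * (m * Z)                          ≡⟨ cong (λ y → (m + a) * y - m * (m * Z)) (split Y m Z) ⟩
    (m + a) * (m * Z + (Y - m * Z)) - m * (m * Z)      ≡⟨ cong (λ w → (m + a) * (m * Z + w) - m * (m * Z)) eq ⟩
    (m + a) * (m * Z + a * (K * Z + a * T)) - m * (m * Z) ≡⟨ expand m a K Z T ⟩
    a * ((+ 1 + K) * (m * Z) + a * (K * Z + (m + a) * T)) ∎
    where
    split : ∀ Y m Z → Y ≡ m * Z + (Y - m * Z)
    split = solve-∀
    expand : ∀ m a K Z T → (m + a) * (m * Z + a * (K * Z + a * T)) - m * (m * Z) ≡
                            a * ((+ 1 + K) * (m * Z) + a * (K * Z + (m + a) * T))
    expand = solve-∀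

prime^-∣-*-cancelʳ : ∀ {p x} → Prime p → ¬ p ∣ x → ∀ j a → p ℕ.^ j ∣ a ℕ.* x → p ℕ.^ j ∣ a
prime^-∣-*-cancelʳ         p-prime p∤x zero    a _ = ℕD.1∣ a
prime^-∣-*-cancelʳ {p} {x} p-prime p∤x (suc j) a pʲ⁺¹∣ax
  with euclidsLemma a x p-prime (ℕD.∣-trans (ℕD.m∣m*n (p ℕ.^ j)) pʲ⁺¹∣ax)
... | inj₂ p∣x = contradiction p∣x p∤x
... | inj₁ (divides a′ refl) =
  subst (p ℕ.* p ℕ.^ j ∣_) (ℕP.*-comm p a′) (ℕD.*-monoʳ-∣ p (prime^-∣-*-cancelʳ p-prime p∤x j a′ pʲ∣a′x))
  where
  instance _ = prime⇒nonZero p-prime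
  pʲ∣a′x : p ℕ.^ j ∣ a′ ℕ.* x
  pʲ∣a′x = ℕD.*-cancelˡ-∣ p (subst (p ℕ.* p ℕ.^ j ∣_)
    (trans (cong (ℕ._* x) (ℕP.*-comm a′ p)) (ℕP.*-assoc p a′ x)) pʲ⁺¹∣ax)

-- p^j divides (m + a)^k - m^k = a (k m^(k-1) + a T), whose second factor is prime to p.
prime^∣Φ-values⇒∣ : ∀ {p} → Prime p → ∀ k′ m a → ¬ p ∣ suc k′ → + p ∣ℤ ⟦ Φ (suc k′) ⟧ m → + p ∣ℤ + a →
  ∀ j → + (p ℕ.^ j) ∣ℤ ⟦ Φ (suc k′) ⟧ m → + (p ℕ.^ j) ∣ℤ ⟦ Φ (suc k′) ⟧ (m + + a) → p ℕ.^ j ∣ a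
prime^∣Φ-values⇒∣ {p} p-prime k′ m a p∤k p∣Φm p∣a j pʲ∣Φm pʲ∣Φm+a =
  prime^-∣-*-cancelʳ p-prime p∤X j a (subst (p ℕ.^ j ∣_) (ℤP.abs-* (+ a) X) (ℤD.∣⇒∣ᵤ pʲ∣aX))
  where
  k = suc k′
  difference = binomial-difference k′ m (+ a)
  X = + k * m ^ k′ + + a * proj₁ difference
  pʲ∣aX : + (p ℕ.^ j) ∣ℤ + a * X
  pʲ∣aX = subst (+ (p ℕ.^ j) ∣ℤ_) (trans (cancel ((m + + a) ^ k) (m ^ k)) (proj₂ difference))
    (ℤD.∣m∣n⇒∣m-n
      (subst (+ (p ℕ.^ j) ∣ℤ_) (sym (factorisation (cyclotomic k′) (m + + a)))
             (ℤD.∣m⇒∣m*n (⟦ divisorProd k k′ ⟧ (m + + a)) pʲ∣Φm+a))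
      (subst (+ (p ℕ.^ j) ∣ℤ_) (sym (factorisation (cyclotomic k′) m))
             (ℤD.∣m⇒∣m*n (⟦ divisorProd k k′ ⟧ m) pʲ∣Φm)))
    where
    cancel : ∀ y z → (y - + 1) - (z - + 1) ≡ y - z
    cancel = solve-∀
  p∤X : ¬ p ∣ ∣ X ∣
  p∤X p∣X = [ (λ p∣k → p∤k (ℤD.∣⇒∣ᵤ p∣k)) , (λ p∣m^k′ → prime∣Φ⇒∤ p-prime k′ p∣Φm (prime-∣ℤ-^ p-prime m k′ p∣m^k′)) ]′
    (prime-∣ℤ-* p-prime (+ k) (m ^ k′) (subst (+ p ∣ℤ_) (cancel (+ k * m ^ k′) (+ a * proj₁ difference))
      (ℤD.∣m∣n⇒∣m-n (ℤD.∣ᵤ⇒∣ {i = X} p∣X) (ℤD.∣m⇒∣m*n (proj₁ difference) p∣a))))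
    where
    cancel : ∀ u w → u + w - w ≡ u
    cancel = solve-∀

IsOrd⇒∤ : ∀ {p} → Prime p → ∀ k f → IsOrd k p f → ¬ p ∣ k
IsOrd⇒∤ {p} p-prime k (suc f′) (_ , k∣pᶠ-1 , _) p∣k =
  ℕ.nonTrivial⇒≢1 {{prime⇒nonTrivial p-prime}} (ℕD.∣1⇒≡1 (ℕD.∣m+n∣m⇒∣n p∣pᶠ-1+1 (ℕD.∣-trans p∣k k∣pᶠ-1)))
  where
  instance _ = prime⇒nonZero p-prime
  p∣pᶠ-1+1 : p ∣ (p ℕ.^ suc f′ ∸ 1) ℕ.+ 1
  p∣pᶠ-1+1 = subst (p ∣_) (sym (ℕP.m∸n+n≡m (ℕP.m^n>0 p (suc f′)))) (ℕD.m∣m*n (p ℕ.^ f′))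

IsOrd-≡1 : ∀ k b f → IsOrd k b f → k ∣ b ∸ 1 → f ≡ 1
IsOrd-≡1 k b (suc zero)    _                 _     = refl
IsOrd-≡1 k b (suc (suc f)) (_ , _ , minimal) k∣b-1 =
  contradiction (subst (λ c → k ∣ c ∸ 1) (sym (ℕP.*-identityʳ b)) k∣b-1) (minimal 1 ℕP.≤-refl (s≤s (s≤s z≤n)))

IsVal-≤ : ∀ p a v j → IsVal p a v → p ℕ.^ j ∣ a → j ℕ.≤ v
IsVal-≤ p a v j (_ , pᵛ⁺¹∤a) pʲ∣a = ℕP.≮⇒≥ λ v<j → pᵛ⁺¹∤a (ℕD.∣-trans (pᵛ⁺¹∣pʲ v<j) pʲ∣a)
  where
  pᵛ⁺¹∣pʲ : v ℕ.< j → p ℕ.^ suc v ∣ p ℕ.^ j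
  pᵛ⁺¹∣pʲ v<j = divides (p ℕ.^ (j ∸ suc v)) (begin
    p ℕ.^ j                              ≡⟨ cong (p ℕ.^_) (ℕP.m+[n∸m]≡n v<j) ⟨
    p ℕ.^ (suc v ℕ.+ (j ∸ suc v))        ≡⟨ ℕP.^-distribˡ-+-* p (suc v) (j ∸ suc v) ⟩
    p ℕ.^ suc v ℕ.* p ℕ.^ (j ∸ suc v)    ≡⟨ ℕP.*-comm (p ℕ.^ suc v) _ ⟩
    p ℕ.^ (j ∸ suc v) ℕ.* p ℕ.^ suc v    ∎)

floorDivMul-1 : ∀ v → floorDivMul v 1 ≡ v
floorDivMul-1 v = trans (ℕP.*-identityʳ (v ℕ./ 1)) (n/1≡n v)

proposition2 : (a k : ℕ) (m : ℤ) → 0 < a → 2 < k → (¬ (2 ∣ k) ⊎ 4 ∣ k)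
    → MultDep k ((ℤ.- m) +ζ) ((ℤ.- (m ℤ.+ + a)) +ζ)
    → ¬ RootOfUnity k ((ℤ.- m) +ζ)
    → ¬ RootOfUnity k ((ℤ.- (m ℤ.+ + a)) +ζ)
    → ¬ ((m , a , k) ≡ (-[1+ 0 ] , 2 , 4))
    → (p : ℕ) → Prime p → p ∣ ∣ evalℤ (Φ k) m ℤ.* evalℤ (Φ k) (m ℤ.+ + a) ∣
    → (fp : ℕ) → IsOrd k p fp
    → (n : ℕ) → IsVal p (gcd ∣ evalℤ (Φ k) m ∣ ∣ evalℤ (Φ k) (m ℤ.+ + a) ∣) n
    → (v : ℕ) → IsVal p a v
    → (n ≤ floorDivMul v fp) × (fp ∣ n)
proposition2 _ _        _ _ _ _ _   _ _ _ _ _       _ fp _   zero      _            _ _     = z≤n , fp ℕD.∣0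
proposition2 a (suc k′) m _ _ _ dep _ _ _ p p-prime _ fp ord n@(suc _) (pⁿ∣gcd , _) v val-a =
  subst (λ f → n ≤ floorDivMul v f × f ∣ n) (sym f≡1)
    (subst (n ≤_) (sym (floorDivMul-1 v)) (IsVal-≤ p a v n val-a pⁿ∣a) , ℕD.1∣ n)
  where
  Φm Φm+a : ℤ
  Φm = evalℤ (Φ (suc k′)) m
  Φm+a = evalℤ (Φ (suc k′)) (m ℤ.+ + a)
  pⁿ∣Φm : + (p ℕ.^ n) ∣ℤ Φm
  pⁿ∣Φm = ℤD.∣ᵤ⇒∣ (ℕD.∣-trans pⁿ∣gcd (gcd[m,n]∣m ∣ Φm ∣ ∣ Φm+a ∣))
  pⁿ∣Φm+a : + (p ℕ.^ n) ∣ℤ Φm+a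
  pⁿ∣Φm+a = ℤD.∣ᵤ⇒∣ (ℕD.∣-trans pⁿ∣gcd (gcd[m,n]∣n ∣ Φm ∣ ∣ Φm+a ∣))
  p∣ : ∀ {z} → + (p ℕ.^ n) ∣ℤ z → + p ∣ℤ z
  p∣ = ℤD.∣-trans (ℤD.∣ᵤ⇒∣ (ℕD.m∣m*n (p ℕ.^ (n ℕ.∸ 1))))
  p∤k : ¬ p ∣ suc k′
  p∤k = IsOrd⇒∤ p-prime (suc k′) fp ord
  f≡1 : fp ≡ 1
  f≡1 = IsOrd-≡1 (suc k′) p fp ord (prime∣Φ⇒k∣p-1 p-prime k′ (p∣ pⁿ∣Φm) p∤k)
  p∣a : + p ∣ℤ + a
  p∣a = multDep⇒∣ p-prime a (suc k′) m dep (p∣ pⁿ∣Φm) (p∣ pⁿ∣Φm+a)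
  pⁿ∣a : p ℕ.^ n ∣ a
  pⁿ∣a = prime^∣Φ-values⇒∣ p-prime k′ m a p∤k (p∣ pⁿ∣Φm) p∣a n pⁿ∣Φm pⁿ∣Φm+a
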